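{- For all $m\geq 0$ and every nonempty partition $\lambda$, $$\rho^{(m+1)}(\lambda)=\sum_{\substack{\phi:Q'\to\mathbb{Z}_{\ge0}\\ \sum_{\alpha\in Q'}\phi(\alpha)\alpha=\lambda}}\ \prod_{\alpha\in Q'}\binom{\phi(\alpha)+\rho^{(m)}(\alpha)-1}{\rho^{(m)}(\alpha)-1},$$ where $\lambda$ is regarded as the vector $(\lambda_1,\lambda_2,\ldots,\lambda_{\ell(\lambda)},0,0,\ldots)\in Q$ and the sum is over finitely supported functions $\phi$.
   Context: Let $\Lambda$ be the ring of symmetric functions over $\mathbb{Q}$ in variables $X=(x_1,x_2,\ldots)$, completed with respect to degree. Write $h_n$, $p_k$, $m_\lambda$ for complete homogeneous, power sum and monomial symmetric functions. Plethysm: for a formal power series $A$ in the $x_i$ and auxiliary commuting variables (e.g. $t$), $p_k(A)$ is obtained from $A$ by replacing every variable by its $k$-th power, and for $F\in\Lambda$, $F(A)$ is obtained by writing $F$ in terms of the $p_k$ and substituting $p_k\mapsto p_k(A)$ (used only when $A$ has zero constant term, or $F$ is a polynomial). The alphabet $tX$ means $(tx_1,tx_2,\ldots)$. Let $\Omega(X)=\sum_{n\ge0}h_n(X)$, $\Omega_0(X)=\Omega(X)-1$, $\Omega_0^{(0)}(X)=h_1(X)$, $\Omega_0^{(m+1)}(X)=\Omega_0(\Omega_0^{(m)}(X))$, and define $B_n^{(m)}$ by $\Omega(\Omega_0^{(m)}(tX))=\sum_{n\ge0}B_n^{(m)}(X)t^n$. Let $Q$ be the set of finitely supported sequences in $\mathbb{Z}_{\ge0}^{\infty}$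 and $Q'=Q\setminus\{0\}$. Define $\rho^{(m)}(\lambda)\in\mathbb{Q}$ by $B_n^{(m)}=\sum_{\lambda\vdash n}\rho^{(m)}(\lambda)m_\lambda$, and for $\alpha\in Q$ set $\rho^{(m)}(\alpha)=\rho^{(m)}(\lambda)$ where $\lambda$ is the weakly decreasing rearrangement of $\alpha$. -}

module Defs where

-- A monomial t^a x₁^e₁ x₂^e₂ ⋯ is represented by the list
-- (a ∷ e₁ ∷ e₂ ∷ … ∷ eₙ ∷ []), trailing zeros being irrelevant: all operations
-- below treat a missing entry as exponent 0.  A series is its coefficient map.

open import Data.Bool using (Bool; true; false; if_then_else_; _∧_)
open import Data.Nat as ℕ using (ℕ; zero; suc; _≡ᵇ_; _≤ᵇ_; _%_; _≤_; _≥_; _>_)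
open import Data.Nat.Properties using (_!≢0)
open import Data.Integer using (+_)
open import Data.Rational using (ℚ; 0ℚ; 1ℚ; _+_; _*_; _-_; _/_)
open import Data.List using (List; []; _∷_; map; foldr; concatMap; upTo; zipWith; filterᵇ; length; replicate; [_])
open import Data.List.Relation.Unary.All using (All)
open import Data.List.Relation.Unary.Linked using (Linked)
open import Data.Product using (_×_)
open import Relation.Binary.PropositionalEquality using (_≢_)

Mono : Set
Mono = List ℕ

Series : Set
Series = Mono → ℚ

ℕtoℚ : ℕ → ℚ
ℕtoℚ n = + n / 1

sumℚ : List ℚ → ℚ
sumℚ = foldr _+_ 0ℚ

prodℚ : List ℚ → ℚ
prodℚ = foldr _*_ 1ℚ

deg : Mono → ℕ
deg = foldr ℕ._+_ 0

allᵇ : {A : Set} → (A → Bool) → List A → Bool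
allᵇ p = foldr (λ x b → p x ∧ b) true

isOne : Mono → Bool
isOne = allᵇ (_≡ᵇ 0)

below : Mono → List Mono
below [] = [ [] ]
below (e ∷ γ) = concatMap (λ a → map (a ∷_) (below γ)) (upTo (suc e))

oneS : Series
oneS γ = if isOne γ then 1ℚ else 0ℚ

_−S_ : Series → Series → Series
(A −S B) γ = A γ - B γ

mulS : Series → Series → Series
mulS A B γ = sumℚ (map (λ β → A β * B (zipWith ℕ._∸_ γ β)) (below γ))

powS : Series → ℕ → Series
powS B zero = oneS
powS B (suc j) = mulS B (powS B j)

-- p_{k+1}(A): every variable (t included) replaced by its (k+1)-th power
pS : ℕ → Series → Series
pS k A γ = if allᵇ (λ e → (e % suc k) ≡ᵇ 0) γ then A (map (λ e → e ℕ./ suc k) γ) else 0ℚ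

-- Σ_{k ≥ 1} p_k(A)/k, for A with zero constant term (only k ≤ deg γ contribute)
psumS : Series → Series
psumS A γ = sumℚ (map (λ k → (+ 1 / suc k) * pS k A γ) (upTo (deg γ)))

-- exp(B) = Σ_j B^j / j!, for B with zero constant term (only j ≤ deg γ contribute)
expS : Series → Series
expS B γ = sumℚ (map (λ j → powS B j γ * (_/_ (+ 1) (j ℕ.!) {{j !≢0}})) (upTo (suc (deg γ))))

-- Ω = Σ_n h_n = exp(Σ_k p_k/k), plethystically evaluated at A (zero constant term)
Ω : Series → Series
Ω A = expS (psumS A)

Ω₀ : Series → Series
Ω₀ A = Ω A −S oneS

-- h₁(tX) = Σ_i t x_i
h₁tX : Series
h₁tX [] = 0ℚ
h₁tX (a ∷ e) = if (a ≡ᵇ 1) ∧ (deg e ≡ᵇ 1) then 1ℚ else 0ℚ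

Ω₀^ : ℕ → Series
Ω₀^ zero = h₁tX
Ω₀^ (suc m) = Ω₀ (Ω₀^ m)

-- Ω(Ω₀^{(m)}(tX)) = Σ_n B_n^{(m)}(X) tⁿ
BGen : ℕ → Series
BGen m = Ω (Ω₀^ m)

-- ρ^{(m)}(lam) for a partition lam ⊢ n: coefficient of m_λ in B_n^{(m)},
-- i.e. coefficient of tⁿ x₁^{λ₁} x₂^{λ₂} ⋯ in Ω(Ω₀^{(m)}(tX)).
ρP : ℕ → List ℕ → ℚ
ρP m lam = BGen m (deg lam ∷ lam)

insertDesc : ℕ → List ℕ → List ℕ
insertDesc x [] = [ x ]
insertDesc x (y ∷ ys) = if y ≤ᵇ x then x ∷ y ∷ ys else y ∷ insertDesc x ys

sortDesc : List ℕ → List ℕ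
sortDesc = foldr insertDesc []

-- ρ^{(m)}(α) for α ∈ Q (α given by a finite list, trailing zeros implicit)
ρ : ℕ → List ℕ → ℚ
ρ m α = ρP m (sortDesc α)

IsNonemptyPartition : List ℕ → Set
IsNonemptyPartition lam = (lam ≢ []) × All (_> 0) lam × Linked _≥_ lam

-- binom(φ + r - 1, r - 1) written (by symmetry) as the generalised binomial
-- binom(φ + r - 1, φ) = r (r+1) ⋯ (r+φ-1) / φ!   (r rational, φ natural)
multichoose : ℚ → ℕ → ℚ
multichoose r φ = prodℚ (map (λ i → r + ℕtoℚ i) (upTo φ)) * (_/_ (+ 1) (φ ℕ.!) {{φ !≢0}})

boxes : ℕ → ℕ → List (List ℕ)
boxes zero b = [ [] ]
boxes (suc d) b = concatMap (λ c → map (c ∷_) (boxes d b)) (upTo (suc b))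

eqᵇ : List ℕ → List ℕ → Bool
eqᵇ [] [] = true
eqᵇ [] (_ ∷ _) = false
eqᵇ (_ ∷ _) [] = false
eqᵇ (x ∷ xs) (y ∷ ys) = (x ≡ᵇ y) ∧ eqᵇ xs ys

-- The candidate support: all α ∈ Q' with α ≤ lam componentwise; every α with
-- φ(α) > 0 in a solution of Σ φ(α) α = lam lies here (represented with length ℓ(lam)).
supportCands : List ℕ → List (List ℕ)
supportCands lam = filterᵇ (λ α → if isOne α then false else true) (below lam)

linComb : ℕ → List ℕ → List (List ℕ) → List ℕ
linComb ℓ c D = foldr (zipWith ℕ._+_) (replicate ℓ 0) (zipWith (λ ci α → map (ci ℕ.*_) α) c D)

-- The finitely supported φ : Q' → ℤ≥0 with Σ φ(α) α = lam, encoded as the list of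
-- their values on supportCands lam (values are ≤ |λ| since each α ≠ 0).
solutions : List ℕ → List (List ℕ)
solutions lam = filterᵇ (λ c → eqᵇ (linComb (length lam) c (supportCands lam)) lam)
                      (boxes (length (supportCands lam)) (deg lam))

-- Σ_φ Π_{α ∈ Q'} binom(φ(α) + ρ^{(m)}(α) - 1, ρ^{(m)}(α) - 1)
-- (factors with φ(α) = 0 equal 1 and are omitted)
rhsSum : ℕ → List ℕ → ℚ
rhsSum m lam = sumℚ (map (λ c → prodℚ (zipWith (λ ci α → multichoose (ρ m α) ci) c (supportCands lam))) (solutions lam))

module Submission where

-- Let C = Ω(Ω₀^{(m)}(tX)) − 1 = Ω₀^{(m+1)}(tX), so that Ω(Ω₀^{(m+1)}(tX)) = exp(Σ_k p_k(C)/k). Since C is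
-- symmetric and t counts its degree, below t^{|λ|}x^λ it equals Σ_α ρ^{(m)}(α) t^{|α|}x^α over the nonzero
-- α ≤ λ, so Σ_k p_k(C)/k agrees there with Σ_α −ρ^{(m)}(α) log(1 − t^{|α|}x^α). Instead of manipulating
-- exponentials, observe that exp(G) and Π_α (1 − t^{|α|}x^α)^{−ρ^{(m)}(α)} both solve ∂F = ∂G · F for the
-- Euler derivation ∂, and a solution is determined by its constant term. The coefficient of t^{|λ|}x^λ in the
-- product is then read off from the negative binomial series of the factors.

open import Defs
open import Algebra.Bundles using (Ring)
open import Data.Bool using (Bool; true; false; if_then_else_; _∧_; T)
import Data.Bool.Properties as Bool
import Data.Integer as ℤ
import Data.Integer.Properties as ℤₚ
open import Data.List using (List; []; _∷_; [_]; _++_; map; concatMap; zipWith; filterᵇ; upTo; length; replicate)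
import Data.List.Properties as List
open import Data.List.Relation.Binary.Pointwise as Pointwise using (Pointwise; []; _∷_; Pointwise-length)
open import Data.List.Relation.Unary.All as All using (All; []; _∷_)
open import Data.List.Relation.Unary.All.Properties using (all-filter; all-upTo; concat⁺; filter⁺; map⁺)
open import Data.Nat as ℕ using (ℕ; zero; suc; _∸_; _≤_; _<_; z≤n; s≤s; _≤ᵇ_; _!)
import Data.Nat.DivMod as ℕ
import Data.Nat.Properties as ℕₚ
open import Data.Nat.Properties using (_!≢0; m*n≢0)
open import Data.Nat.Tactic.RingSolver using (solve-∀)
open import Data.Product using (∃; _,_; _×_; proj₁; proj₂)
open import Data.Rational using (ℚ; 0ℚ; 1ℚ; _+_; _*_; _-_; _/_; toℚᵘ)
open import Data.Rational.Properties
open import Algebra.Properties.Semiring.Mult (Ring.semiring +-*-ring) using (×-homo-+; ×1-homo-*) renaming (_×_ to _times_)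
open import Data.Rational.Solver using (module +-*-Solver)
open import Data.Rational.Unnormalised using (mkℚᵘ; *≡*) renaming (_≃_ to _≃ᵘ_)
import Data.Rational.Unnormalised.Properties as ℚᵘₚ
open import Data.Sum using (_⊎_; inj₁; inj₂)
open import Function using (_∘_)
open import Function.Bundles using (mk⇔)
open import Relation.Binary.Definitions using (Decidable; DecidableEquality)
open import Relation.Binary.PropositionalEquality hiding ([_])
open import Relation.Nullary.Decidable using (Dec; does; yes; no; dec-true; dec-false; does-⇔; _×-dec_; T?)
open import Relation.Nullary.Negation using (¬_; contradiction)

open ≡-Reasoning
open +-*-Solver using (solve; _:+_; _:*_; _:=_; con)

∑ : {A : Set} → List A → (A → ℚ) → ℚ
∑ xs f = sumℚ (map f xs)

syntax ∑ xs (λ x → e) = ∑[ x ∈ xs ] e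

∑< : ℕ → (ℕ → ℚ) → ℚ
∑< n = ∑ (upTo n)

syntax ∑< n (λ i → e) = ∑[ i < n ] e

module _ {A : Set} where

  ∑-cong : ∀ (xs : List A) {f g : A → ℚ} → (∀ x → f x ≡ g x) → ∑ xs f ≡ ∑ xs g
  ∑-cong []       f≗g = refl
  ∑-cong (x ∷ xs) f≗g = cong₂ _+_ (f≗g x) (∑-cong xs f≗g)

  ∑-congᴬ : ∀ {xs : List A} {f g : A → ℚ} → All (λ x → f x ≡ g x) xs → ∑ xs f ≡ ∑ xs g
  ∑-congᴬ []         = refl
  ∑-congᴬ (fx≡gx ∷ p) = cong₂ _+_ fx≡gx (∑-congᴬ p)

  ∑-zero : ∀ (xs : List A) → ∑ xs (λ _ → 0ℚ) ≡ 0ℚ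
  ∑-zero []       = refl
  ∑-zero (x ∷ xs) = trans (+-identityˡ _) (∑-zero xs)

  ∑-zeroᴬ : ∀ {xs : List A} {f : A → ℚ} → All (λ x → f x ≡ 0ℚ) xs → ∑ xs f ≡ 0ℚ
  ∑-zeroᴬ {xs} p = trans (∑-congᴬ p) (∑-zero xs)

  ∑-++ : ∀ (xs ys : List A) (f : A → ℚ) → ∑ (xs ++ ys) f ≡ ∑ xs f + ∑ ys f
  ∑-++ []       ys f = sym (+-identityˡ _)
  ∑-++ (x ∷ xs) ys f = trans (cong (f x +_) (∑-++ xs ys f)) (sym (+-assoc (f x) _ _))

  ∑-+ : ∀ (xs : List A) (f g : A → ℚ) → ∑[ x ∈ xs ] (f x + g x) ≡ ∑ xs f + ∑ xs g
  ∑-+ []       f g = sym (+-identityˡ _)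
  ∑-+ (x ∷ xs) f g = trans (cong (f x + g x +_) (∑-+ xs f g)) (interchange (f x) (g x) _ _)
    where
    interchange : ∀ a b c d → (a + b) + (c + d) ≡ (a + c) + (b + d)
    interchange = solve 4 (λ a b c d → (a :+ b) :+ (c :+ d) := (a :+ c) :+ (b :+ d)) refl

  *-distribˡ-∑ : ∀ c (xs : List A) (f : A → ℚ) → c * ∑ xs f ≡ ∑[ x ∈ xs ] (c * f x)
  *-distribˡ-∑ c []       f = *-zeroʳ c
  *-distribˡ-∑ c (x ∷ xs) f = trans (*-distribˡ-+ c (f x) _) (cong (c * f x +_) (*-distribˡ-∑ c xs f))

  *-distribʳ-∑ : ∀ c (xs : List A) (f : A → ℚ) → ∑ xs f * c ≡ ∑[ x ∈ xs ] (f x * c)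
  *-distribʳ-∑ c xs f = trans (*-comm _ c) (trans (*-distribˡ-∑ c xs f) (∑-cong xs (λ x → *-comm c (f x))))

  ∑-filterᵇ : ∀ p (xs : List A) (f : A → ℚ) → ∑ (filterᵇ p xs) f ≡ ∑[ x ∈ xs ] (if p x then f x else 0ℚ)
  ∑-filterᵇ p []       f = refl
  ∑-filterᵇ p (x ∷ xs) f with p x
  ... | true  = cong (f x +_) (∑-filterᵇ p xs f)
  ... | false = trans (∑-filterᵇ p xs f) (sym (+-identityˡ _))

module _ {A B : Set} where

  ∑-map : ∀ (h : A → B) (xs : List A) (f : B → ℚ) → ∑ (map h xs) f ≡ ∑ xs (f ∘ h)
  ∑-map h []       f = refl
  ∑-map h (x ∷ xs) f = cong (f (h x) +_) (∑-map h xs f)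

  ∑-concatMap : ∀ (g : A → List B) (xs : List A) (f : B → ℚ) → ∑ (concatMap g xs) f ≡ ∑[ x ∈ xs ] ∑ (g x) f
  ∑-concatMap g []       f = refl
  ∑-concatMap g (x ∷ xs) f = trans (∑-++ (g x) _ f) (cong (∑ (g x) f +_) (∑-concatMap g xs f))

  ∑-comm : ∀ (xs : List A) (ys : List B) (f : A → B → ℚ) → ∑[ x ∈ xs ] ∑ ys (f x) ≡ ∑[ y ∈ ys ] ∑[ x ∈ xs ] f x y
  ∑-comm []       ys f = sym (∑-zero ys)
  ∑-comm (x ∷ xs) ys f = trans (cong (∑ ys (f x) +_) (∑-comm xs ys f)) (sym (∑-+ ys (f x) (λ y → ∑[ x′ ∈ xs ] f x′ y)))

if-*ʳ : ∀ b x y → (if b then x else 0ℚ) * y ≡ (if b then x * y else 0ℚ)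
if-*ʳ true  x y = refl
if-*ʳ false x y = *-zeroˡ y

if-*ˡ : ∀ b x y → x * (if b then y else 0ℚ) ≡ (if b then x * y else 0ℚ)
if-*ˡ true  x y = refl
if-*ˡ false x y = *-zeroʳ x

∑<-cong : ∀ n {f g : ℕ → ℚ} → (∀ i → i < n → f i ≡ g i) → ∑< n f ≡ ∑< n g
∑<-cong n f≗g = ∑-congᴬ (All.map (f≗g _) (all-upTo n))

∑<-zero : ∀ n {f : ℕ → ℚ} → (∀ i → i < n → f i ≡ 0ℚ) → ∑< n f ≡ 0ℚ
∑<-zero n f≗0 = ∑-zeroᴬ (All.map (f≗0 _) (all-upTo n))

∑<-suc : ∀ n (f : ℕ → ℚ) → ∑< (suc n) f ≡ f 0 + ∑[ i < n ] f (suc i)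
∑<-suc n f = cong (f 0 +_) (cong sumℚ (trans (List.map-applyUpTo suc f n) (sym (List.map-upTo (f ∘ suc) n))))

∑<-sucʳ : ∀ n (f : ℕ → ℚ) → ∑< (suc n) f ≡ ∑< n f + f n
∑<-sucʳ n f = begin
  ∑< (suc n) f            ≡⟨ cong (λ xs → ∑ xs f) (List.upTo-∷ʳ n) ⟨
  ∑ (upTo n ++ n ∷ []) f  ≡⟨ ∑-++ (upTo n) (n ∷ []) f ⟩
  ∑< n f + (f n + 0ℚ)     ≡⟨ cong (∑< n f +_) (+-identityʳ (f n)) ⟩
  ∑< n f + f n            ∎

∑<-extend : ∀ {m n} (f : ℕ → ℚ) → m ≤ n → (∀ i → m ≤ i → i < n → f i ≡ 0ℚ) → ∑< n f ≡ ∑< m f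
∑<-extend {n = zero}  f z≤n _ = refl
∑<-extend {m} {suc n} f m≤1+n vanish with ℕₚ.m≤n⇒m<n∨m≡n m≤1+n
... | inj₂ refl = refl
... | inj₁ m<1+n = begin
  ∑< (suc n) f  ≡⟨ ∑<-sucʳ n f ⟩
  ∑< n f + f n  ≡⟨ cong₂ _+_ (∑<-extend f m≤n (λ i m≤i i<n → vanish i m≤i (ℕₚ.m<n⇒m<1+n i<n)))
                             (vanish n m≤n ℕₚ.≤-refl) ⟩
  ∑< m f + 0ℚ   ≡⟨ +-identityʳ _ ⟩
  ∑< m f        ∎
  where
  m≤n : m ≤ n
  m≤n = ℕₚ.≤-pred m<1+n

∑<-reverse : ∀ n (f : ℕ → ℚ) → ∑[ i < n ] f (n ∸ suc i) ≡ ∑< n f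
∑<-reverse zero    f = refl
∑<-reverse (suc n) f = begin
  ∑[ i < suc n ] f (n ∸ i)        ≡⟨ ∑<-suc n (λ i → f (n ∸ i)) ⟩
  f n + ∑[ i < n ] f (n ∸ suc i)  ≡⟨ cong (f n +_) (∑<-reverse n f) ⟩
  f n + ∑< n f                    ≡⟨ +-comm (f n) _ ⟩
  ∑< n f + f n                    ≡⟨ ∑<-sucʳ n f ⟨
  ∑< (suc n) f                    ∎

∑<-triangle : ∀ e (g : ℕ → ℕ → ℚ) →
  ∑[ b < suc e ] ∑[ d < suc b ] g d b ≡ ∑[ d < suc e ] ∑[ k < suc (e ∸ d) ] g d (d ℕ.+ k)
∑<-triangle zero    g = refl
∑<-triangle (suc e) g = begin
  ∑[ b < suc (suc e) ] ∑[ d < suc b ] g d b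
    ≡⟨ ∑<-sucʳ (suc e) (λ b → ∑[ d < suc b ] g d b) ⟩
  ∑[ b < suc e ] ∑[ d < suc b ] g d b + ∑[ d < suc (suc e) ] g d (suc e)
    ≡⟨ cong₂ _+_ (∑<-triangle e g) (∑<-sucʳ (suc e) (λ d → g d (suc e))) ⟩
  ∑< (suc e) inner + (∑[ d < suc e ] g d (suc e) + g (suc e) (suc e))
    ≡⟨ +-assoc (∑< (suc e) inner) _ _ ⟨
  ∑< (suc e) inner + ∑[ d < suc e ] g d (suc e) + g (suc e) (suc e)
    ≡⟨ cong₂ _+_ (∑-+ (upTo (suc e)) inner (λ d → g d (suc e))) (last-column (suc e)) ⟨
  ∑[ d < suc e ] (inner d + g d (suc e)) + ∑[ k < 1 ] g (suc e) (suc e ℕ.+ k)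
    ≡⟨ cong₂ _+_ (∑<-cong (suc e) extend-row) (cong (λ n → ∑[ k < suc n ] g (suc e) (suc e ℕ.+ k)) (ℕₚ.n∸n≡0 e)) ⟨
  ∑[ d < suc e ] row d + row (suc e)
    ≡⟨ ∑<-sucʳ (suc e) row ⟨
  ∑[ d < suc (suc e) ] row d ∎
  where
  inner row : ℕ → ℚ
  inner d = ∑[ k < suc (e ∸ d) ] g d (d ℕ.+ k)
  row   d = ∑[ k < suc (suc e ∸ d) ] g d (d ℕ.+ k)
  last-column : ∀ n → ∑[ k < 1 ] g n (n ℕ.+ k) ≡ g n n
  last-column n = trans (+-identityʳ _) (cong (g n) (ℕₚ.+-identityʳ n))
  extend-row : ∀ d → d < suc e → row d ≡ inner d + g d (suc e)
  extend-row d d<1+e = begin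
    row d                                     ≡⟨ cong (λ n → ∑[ k < suc n ] g d (d ℕ.+ k)) (ℕₚ.+-∸-assoc 1 d≤e) ⟩
    ∑[ k < suc (suc (e ∸ d)) ] g d (d ℕ.+ k)  ≡⟨ ∑<-sucʳ (suc (e ∸ d)) (λ k → g d (d ℕ.+ k)) ⟩
    inner d + g d (d ℕ.+ suc (e ∸ d))         ≡⟨ cong (λ n → inner d + g d n) (trans (ℕₚ.+-suc d (e ∸ d)) (cong suc (ℕₚ.m+[n∸m]≡n d≤e))) ⟩
    inner d + g d (suc e)                     ∎
    where
    d≤e : d ≤ e
    d≤e = ℕₚ.≤-pred d<1+e

∑<-δ : ∀ n x (h : ℕ → ℚ) →
  ∑[ a < suc n ] (if does (a ℕₚ.≟ x) then h a else 0ℚ) ≡ (if does (x ℕₚ.≤? n) then h x else 0ℚ)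
∑<-δ n zero h = begin
  ∑[ a < suc n ] (if does (a ℕₚ.≟ 0) then h a else 0ℚ)  ≡⟨ ∑<-suc n (λ a → if does (a ℕₚ.≟ 0) then h a else 0ℚ) ⟩
  h 0 + ∑< n (λ _ → 0ℚ)                                 ≡⟨ cong (h 0 +_) (∑-zero (upTo n)) ⟩
  h 0 + 0ℚ                                              ≡⟨ +-identityʳ (h 0) ⟩
  h 0                                                   ∎
∑<-δ zero    (suc x) h = refl
∑<-δ (suc n) (suc x) h = begin
  ∑[ a < suc (suc n) ] (if does (a ℕₚ.≟ suc x) then h a else 0ℚ)   ≡⟨ ∑<-suc (suc n) (λ a → if does (a ℕₚ.≟ suc x) then h a else 0ℚ) ⟩
  0ℚ + ∑[ a < suc n ] (if does (a ℕₚ.≟ x) then h (suc a) else 0ℚ)  ≡⟨ +-identityˡ _ ⟩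
  ∑[ a < suc n ] (if does (a ℕₚ.≟ x) then h (suc a) else 0ℚ)       ≡⟨ ∑<-δ n x (λ a → h (suc a)) ⟩
  (if does (x ℕₚ.≤? n) then h (suc x) else 0ℚ)                     ≡⟨ cong (if_then h (suc x) else 0ℚ) (≤?-suc x) ⟨
  (if does (suc x ℕₚ.≤? suc n) then h (suc x) else 0ℚ)             ∎
  where
  ≤?-suc : ∀ x → does (suc x ℕₚ.≤? suc n) ≡ does (x ℕₚ.≤? n)
  ≤?-suc zero    = refl
  ≤?-suc (suc x) = refl

1/ℕ : (n : ℕ) → .{{ℕ.NonZero n}} → ℚ
1/ℕ n = ℤ.+ 1 / n

toℚᵘ-/ : ∀ a d → toℚᵘ (ℤ.+ a / suc d) ≃ᵘ mkℚᵘ (ℤ.+ a) d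
toℚᵘ-/ a d = toℚᵘ-fromℚᵘ (mkℚᵘ (ℤ.+ a) d)

ℕtoℚ-as-multiple : ∀ n → ℕtoℚ n ≡ n times 1ℚ
ℕtoℚ-as-multiple zero    = refl
ℕtoℚ-as-multiple (suc n) = trans ℕtoℚ-suc (cong (1ℚ +_) (ℕtoℚ-as-multiple n))
  where
  ℕtoℚ-suc : ℕtoℚ (suc n) ≡ 1ℚ + ℕtoℚ n
  ℕtoℚ-suc = toℚᵘ-injective (ℚᵘₚ.≃-trans (toℚᵘ-/ (suc n) 0) (ℚᵘₚ.≃-sym (ℚᵘₚ.≃-trans
    (toℚᵘ-homo-+ 1ℚ (ℕtoℚ n)) (ℚᵘₚ.≃-trans (ℚᵘₚ.+-congʳ (toℚᵘ 1ℚ) (toℚᵘ-/ n 0))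
    (*≡* (cong (ℤ._* ℤ.+ 1) (cong (λ z → ℤ.1ℤ ℤ.+ z) (ℤₚ.*-identityʳ (ℤ.+ n)))))))))

ℕtoℚ-+ : ∀ m n → ℕtoℚ (m ℕ.+ n) ≡ ℕtoℚ m + ℕtoℚ n
ℕtoℚ-+ m n rewrite ℕtoℚ-as-multiple (m ℕ.+ n) | ℕtoℚ-as-multiple m | ℕtoℚ-as-multiple n = ×-homo-+ 1ℚ m n

ℕtoℚ-* : ∀ m n → ℕtoℚ (m ℕ.* n) ≡ ℕtoℚ m * ℕtoℚ n
ℕtoℚ-* m n rewrite ℕtoℚ-as-multiple (m ℕ.* n) | ℕtoℚ-as-multiple m | ℕtoℚ-as-multiple n = ×1-homo-* m n

1/ℕ-inverseˡ : ∀ n → 1/ℕ (suc n) * ℕtoℚ (suc n) ≡ 1ℚ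
1/ℕ-inverseˡ n = toℚᵘ-injective (ℚᵘₚ.≃-trans (toℚᵘ-homo-* (1/ℕ (suc n)) (ℕtoℚ (suc n)))
  (ℚᵘₚ.≃-trans (ℚᵘₚ.*-cong (toℚᵘ-/ 1 n) (toℚᵘ-/ (suc n) 0)) (ℚᵘₚ.*-inverseˡ (mkℚᵘ (ℤ.+ suc n) 0))))

1/ℕ-* : ∀ m n → 1/ℕ (suc m ℕ.* suc n) ≡ 1/ℕ (suc m) * 1/ℕ (suc n)
1/ℕ-* m n = toℚᵘ-injective (ℚᵘₚ.≃-trans (toℚᵘ-/ 1 (n ℕ.+ m ℕ.* suc n)) (ℚᵘₚ.≃-sym
  (ℚᵘₚ.≃-trans (toℚᵘ-homo-* (1/ℕ (suc m)) (1/ℕ (suc n))) (ℚᵘₚ.*-cong (toℚᵘ-/ 1 m) (toℚᵘ-/ 1 n)))))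

1/! : ℕ → ℚ
1/! j = 1/ℕ (j !) {{j !≢0}}

ℕtoℚ-*-1/!-suc : ∀ j → ℕtoℚ (suc j) * 1/! (suc j) ≡ 1/! j
ℕtoℚ-*-1/!-suc j = cancel j (j !) {{j !≢0}}
  where
  cancel : ∀ n m .{{_ : ℕ.NonZero m}} → ℕtoℚ (suc n) * 1/ℕ (suc n ℕ.* m) {{m*n≢0 (suc n) m}} ≡ 1/ℕ m
  cancel n (suc m) = begin
    ℕtoℚ (suc n) * 1/ℕ (suc n ℕ.* suc m)        ≡⟨ cong (ℕtoℚ (suc n) *_) (1/ℕ-* n m) ⟩
    ℕtoℚ (suc n) * (1/ℕ (suc n) * 1/ℕ (suc m))  ≡⟨ *-assoc (ℕtoℚ (suc n)) _ _ ⟨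
    ℕtoℚ (suc n) * 1/ℕ (suc n) * 1/ℕ (suc m)    ≡⟨ cong (_* 1/ℕ (suc m)) (trans (*-comm (ℕtoℚ (suc n)) (1/ℕ (suc n))) (1/ℕ-inverseˡ n)) ⟩
    1ℚ * 1/ℕ (suc m)                            ≡⟨ *-identityˡ _ ⟩
    1/ℕ (suc m)                                 ∎

ℕtoℚ-*-cancelˡ : ∀ n .{{_ : ℕ.NonZero n}} {x y} → ℕtoℚ n * x ≡ ℕtoℚ n * y → x ≡ y
ℕtoℚ-*-cancelˡ (suc k) {x} {y} eq = begin
  x                                 ≡⟨ scale-back x ⟨
  1/ℕ (suc k) * (ℕtoℚ (suc k) * x)  ≡⟨ cong (1/ℕ (suc k) *_) eq ⟩
  1/ℕ (suc k) * (ℕtoℚ (suc k) * y)  ≡⟨ scale-back y ⟩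
  y                                 ∎
  where
  scale-back : ∀ z → 1/ℕ (suc k) * (ℕtoℚ (suc k) * z) ≡ z
  scale-back z = trans (sym (*-assoc (1/ℕ (suc k)) (ℕtoℚ (suc k)) z)) (trans (cong (_* z) (1/ℕ-inverseˡ k)) (*-identityˡ z))

infix 4 _≤ᴹ_ _≤ᴹ?_ _≟ᴹ_
infixl 6 _⊕_ _⊖_

_≤ᴹ_ : Mono → Mono → Set
_≤ᴹ_ = Pointwise _≤_

_≤ᴹ?_ : Decidable _≤ᴹ_
_≤ᴹ?_ = Pointwise.decidable ℕₚ._≤?_

_≟ᴹ_ : DecidableEquality Mono
_≟ᴹ_ = List.≡-dec ℕₚ._≟_

_⊕_ _⊖_ : Mono → Mono → Mono
_⊕_ = zipWith ℕ._+_
_⊖_ = zipWith ℕ._∸_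

length-zipWith : ∀ (f : ℕ → ℕ → ℕ) {L} xs ys → length xs ≡ L → length ys ≡ L → length (zipWith f xs ys) ≡ L
length-zipWith f []       []       refl _  = refl
length-zipWith f (x ∷ xs) (y ∷ ys) refl eq = cong suc (length-zipWith f xs ys refl (ℕₚ.suc-injective eq))

eqᵇ≡does-≟ᴹ : ∀ x y → eqᵇ x y ≡ does (x ≟ᴹ y)
eqᵇ≡does-≟ᴹ []      []      = refl
eqᵇ≡does-≟ᴹ []      (_ ∷ _) = refl
eqᵇ≡does-≟ᴹ (_ ∷ _) []      = refl
eqᵇ≡does-≟ᴹ (a ∷ x) (b ∷ y) = cong (does (a ℕₚ.≟ b) ∧_) (eqᵇ≡does-≟ᴹ x y)

≤ᴹ-refl : ∀ {γ} → γ ≤ᴹ γ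
≤ᴹ-refl = Pointwise.refl ℕₚ.≤-refl

≤ᴹ-trans : ∀ {α β γ} → α ≤ᴹ β → β ≤ᴹ γ → α ≤ᴹ γ
≤ᴹ-trans = Pointwise.transitive ℕₚ.≤-trans

⊖-≤ᴹ : ∀ {β γ} → β ≤ᴹ γ → γ ⊖ β ≤ᴹ γ
⊖-≤ᴹ []                        = []
⊖-≤ᴹ (_∷_ {x = a} {y = e} _ r) = ℕₚ.m∸n≤m e a ∷ ⊖-≤ᴹ r

⊕-⊖ : ∀ {β γ} → β ≤ᴹ γ → β ⊕ (γ ⊖ β) ≡ γ
⊕-⊖ []          = refl
⊕-⊖ (a≤e ∷ β≤γ) = cong₂ _∷_ (ℕₚ.m+[n∸m]≡n a≤e) (⊕-⊖ β≤γ)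

deg-⊕ : ∀ {β γ} → β ≤ᴹ γ → deg (β ⊕ (γ ⊖ β)) ≡ deg β ℕ.+ deg (γ ⊖ β)
deg-⊕ []                                    = refl
deg-⊕ (_∷_ {x = a} {y = e} {xs = r} {ys = g} _ β≤γ) =
  trans (cong (a ℕ.+ (e ∸ a) ℕ.+_) (deg-⊕ β≤γ)) (interchange a (e ∸ a) (deg r) (deg (g ⊖ r)))
  where
  interchange : ∀ a b c d → (a ℕ.+ b) ℕ.+ (c ℕ.+ d) ≡ (a ℕ.+ c) ℕ.+ (b ℕ.+ d)
  interchange = solve-∀

deg-⊖ : ∀ {β γ} → β ≤ᴹ γ → deg β ℕ.+ deg (γ ⊖ β) ≡ deg γ
deg-⊖ β≤γ = trans (sym (deg-⊕ β≤γ)) (cong deg (⊕-⊖ β≤γ))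

≤ᴹ⇒deg≤ : ∀ {β γ} → β ≤ᴹ γ → deg β ≤ deg γ
≤ᴹ⇒deg≤ []          = z≤n
≤ᴹ⇒deg≤ (a≤e ∷ β≤γ) = ℕₚ.+-mono-≤ a≤e (≤ᴹ⇒deg≤ β≤γ)

deg-⊖< : ∀ {β γ} → β ≤ᴹ γ → deg β ≢ 0 → deg (γ ⊖ β) < deg γ
deg-⊖< {β} {γ} β≤γ deg-β≢0 = subst (deg (γ ⊖ β) <_) (deg-⊖ β≤γ) (ℕₚ.m<n+m (deg (γ ⊖ β)) (ℕₚ.n≢0⇒n>0 deg-β≢0))

isOne⇒deg≡0 : ∀ γ → isOne γ ≡ true → deg γ ≡ 0
isOne⇒deg≡0 []       _ = refl
isOne⇒deg≡0 (0 ∷ γ) h = isOne⇒deg≡0 γ h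

deg≡0⇒isOne : ∀ γ → deg γ ≡ 0 → isOne γ ≡ true
deg≡0⇒isOne []       _ = refl
deg≡0⇒isOne (0 ∷ γ) h = deg≡0⇒isOne γ h

deg≡0-unique : ∀ γ δ → deg γ ≡ 0 → deg δ ≡ 0 → length γ ≡ length δ → γ ≡ δ
deg≡0-unique []          []          _  _  _  = refl
deg≡0-unique (zero ∷ γ)  (zero ∷ δ)  γ₀ δ₀ eq = cong (0 ∷_) (deg≡0-unique γ δ γ₀ δ₀ (ℕₚ.suc-injective eq))

∑≤ : Mono → (Mono → ℚ) → ℚ
∑≤ γ = ∑ (below γ)

syntax ∑≤ γ (λ β → e) = ∑[ β ≤ᴹ γ ] e

below-≤ᴹ : ∀ γ → All (_≤ᴹ γ) (below γ)
below-≤ᴹ []      = [] ∷ []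
below-≤ᴹ (e ∷ γ) = concat⁺ (map⁺ (All.map (λ a<1+e → map⁺ (All.map (ℕₚ.≤-pred a<1+e ∷_) (below-≤ᴹ γ)))
                                          (all-upTo (suc e))))

∑≤-cons : ∀ e γ (f : Mono → ℚ) → ∑[ β ≤ᴹ e ∷ γ ] f β ≡ ∑[ a < suc e ] ∑[ r ≤ᴹ γ ] f (a ∷ r)
∑≤-cons e γ f = trans (∑-concatMap (λ a → map (a ∷_) (below γ)) (upTo (suc e)) f)
                      (∑-cong (upTo (suc e)) (λ a → ∑-map (a ∷_) (below γ) f))

∑≤-cong : ∀ γ {f g : Mono → ℚ} → (∀ β → β ≤ᴹ γ → f β ≡ g β) → ∑≤ γ f ≡ ∑≤ γ g
∑≤-cong γ f≗g = ∑-congᴬ (All.map (f≗g _) (below-≤ᴹ γ))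

∑≤-zero : ∀ γ {f : Mono → ℚ} → (∀ β → β ≤ᴹ γ → f β ≡ 0ℚ) → ∑≤ γ f ≡ 0ℚ
∑≤-zero γ f≗0 = ∑-zeroᴬ (All.map (f≗0 _) (below-≤ᴹ γ))

∑≤-deg≡0 : ∀ γ (f : Mono → ℚ) → deg γ ≡ 0 → ∑≤ γ f ≡ f γ
∑≤-deg≡0 []         f _     = +-identityʳ (f [])
∑≤-deg≡0 (zero ∷ γ) f deg≡0 = trans (∑≤-cons 0 γ f) (trans (+-identityʳ _) (∑≤-deg≡0 γ (λ r → f (0 ∷ r)) deg≡0))

∑≤-δ : ∀ γ w (f : Mono → ℚ) → ∑[ β ≤ᴹ γ ] (if does (β ≟ᴹ w) then f β else 0ℚ) ≡ (if does (w ≤ᴹ? γ) then f w else 0ℚ)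
∑≤-δ []      []      f = +-identityʳ (f [])
∑≤-δ []      (_ ∷ _) f = +-identityʳ 0ℚ
∑≤-δ (e ∷ γ) []      f = trans (∑≤-cons e γ _) (∑<-zero (suc e) (λ a _ → ∑≤-zero γ (λ _ _ → refl)))
∑≤-δ (e ∷ γ) (x ∷ w) f = begin
  ∑[ β ≤ᴹ e ∷ γ ] (if does (β ≟ᴹ x ∷ w) then f β else 0ℚ)                                 ≡⟨ ∑≤-cons e γ _ ⟩
  ∑[ a < suc e ] ∑[ r ≤ᴹ γ ] (if does (a ℕₚ.≟ x) ∧ does (r ≟ᴹ w) then f (a ∷ r) else 0ℚ)  ≡⟨ ∑<-cong (suc e) (λ a _ → inner a) ⟩
  ∑[ a < suc e ] (if does (a ℕₚ.≟ x) then K else 0ℚ)                                      ≡⟨ ∑<-δ e x (λ _ → K) ⟩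
  (if does (x ℕₚ.≤? e) then K else 0ℚ)                                                    ≡⟨ and-if (does (x ℕₚ.≤? e)) ⟩
  (if does (x ℕₚ.≤? e) ∧ does (w ≤ᴹ? γ) then f (x ∷ w) else 0ℚ)                           ∎
  where
  K : ℚ
  K = if does (w ≤ᴹ? γ) then f (x ∷ w) else 0ℚ
  inner : ∀ a → ∑[ r ≤ᴹ γ ] (if does (a ℕₚ.≟ x) ∧ does (r ≟ᴹ w) then f (a ∷ r) else 0ℚ) ≡ (if does (a ℕₚ.≟ x) then K else 0ℚ)
  inner a = by-cases (a ℕₚ.≟ x)
    where
    by-cases : (a≟x : Dec (a ≡ x)) →
      ∑[ r ≤ᴹ γ ] (if does a≟x ∧ does (r ≟ᴹ w) then f (a ∷ r) else 0ℚ) ≡ (if does a≟x then K else 0ℚ)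
    by-cases (yes refl) = ∑≤-δ γ w (λ r → f (a ∷ r))
    by-cases (no _)     = ∑≤-zero γ (λ _ _ → refl)
  and-if : ∀ b → (if b then K else 0ℚ) ≡ (if b ∧ does (w ≤ᴹ? γ) then f (x ∷ w) else 0ℚ)
  and-if true  = refl
  and-if false = refl

scale : ℕ → Mono → Mono
scale j = map (j ℕ.*_)

deg-scale : ∀ j v → deg (scale j v) ≡ j ℕ.* deg v
deg-scale j []      = sym (ℕₚ.*-zeroʳ j)
deg-scale j (x ∷ v) = trans (cong (j ℕ.* x ℕ.+_) (deg-scale j v)) (sym (ℕₚ.*-distribˡ-+ j x (deg v)))

scale-+ : ∀ a b v → scale a v ⊕ scale b v ≡ scale (a ℕ.+ b) v
scale-+ a b []      = refl
scale-+ a b (x ∷ v) = cong₂ _∷_ (sym (ℕₚ.*-distribʳ-+ x a b)) (scale-+ a b v)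

scale-∸ : ∀ a b v → scale a v ⊖ scale b v ≡ scale (a ∸ b) v
scale-∸ a b []      = refl
scale-∸ a b (x ∷ v) = cong₂ _∷_ (sym (ℕₚ.*-distribʳ-∸ x a b)) (scale-∸ a b v)

scale-suc-injective : ∀ s {u v} → scale (suc s) u ≡ scale (suc s) v → u ≡ v
scale-suc-injective s = List.map-injective (λ {x} {y} → ℕₚ.*-cancelˡ-≡ x y (suc s))

scale-mono : ∀ {a b} v → a ≤ b → scale a v ≤ᴹ scale b v
scale-mono []      a≤b = []
scale-mono (x ∷ v) a≤b = ℕₚ.*-monoˡ-≤ x a≤b ∷ scale-mono v a≤b

module _ (v : Mono) (deg-v≢0 : deg v ≢ 0) where

  private
    instance
      deg-v-nonZero : ℕ.NonZero (deg v)
      deg-v-nonZero = ℕ.≢-nonZero deg-v≢0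

  ≤-deg-scale : ∀ j → j ≤ deg (scale j v)
  ≤-deg-scale j = subst (j ≤_) (sym (deg-scale j v)) (ℕₚ.m≤m*n j (deg v))

  scale-injective : ∀ a b → scale a v ≡ scale b v → a ≡ b
  scale-injective a b eq = ℕₚ.*-cancelʳ-≡ a b (deg v) (trans (sym (deg-scale a v)) (trans (cong deg eq) (deg-scale b v)))

  scale-≤ᴹ-cancel : ∀ a b → scale a v ≤ᴹ scale b v → a ≤ b
  scale-≤ᴹ-cancel a b le = ℕₚ.*-cancelʳ-≤ a b (deg v) (subst₂ _≤_ (deg-scale a v) (deg-scale b v) (≤ᴹ⇒deg≤ le))

  multiple? : ∀ γ → (∃ λ J → γ ≡ scale J v) ⊎ (∀ j → γ ≢ scale j v)
  multiple? γ with ℕₚ.anyUpTo? (λ j → γ ≟ᴹ scale j v) (suc (deg γ))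
  ... | yes (J , _ , γ≡Jv) = inj₁ (J , γ≡Jv)
  ... | no  ¬small-multiple = inj₂ λ j γ≡jv → ¬small-multiple
          (j , s≤s (subst (λ γ → j ≤ deg γ) (sym γ≡jv) (≤-deg-scale j)) , γ≡jv)

module _ (s : ℕ) where

  divisibleᴹ : Mono → Bool
  divisibleᴹ = allᵇ (λ e → (e ℕ.% suc s) ℕ.≡ᵇ 0)

  divideᴹ : Mono → Mono
  divideᴹ = map (ℕ._/ suc s)

  scale-divideᴹ : ∀ β → divisibleᴹ β ≡ true → scale (suc s) (divideᴹ β) ≡ β
  scale-divideᴹ []      _ = refl
  scale-divideᴹ (e ∷ β) = by-cases (e ℕ.% suc s ℕₚ.≟ 0)
    where
    by-cases : (e%≟0 : Dec (e ℕ.% suc s ≡ 0)) → does e%≟0 ∧ divisibleᴹ β ≡ true → scale (suc s) (divideᴹ (e ∷ β)) ≡ e ∷ β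
    by-cases (yes e%≡0) β-divisible = cong₂ _∷_ exact (scale-divideᴹ β β-divisible)
      where
      exact : suc s ℕ.* (e ℕ./ suc s) ≡ e
      exact = sym (trans (ℕ.m≡m%n+[m/n]*n e (suc s)) (trans (cong (ℕ._+ e ℕ./ suc s ℕ.* suc s) e%≡0) (ℕₚ.*-comm (e ℕ./ suc s) (suc s))))

  divisibleᴹ-scale : ∀ v → divisibleᴹ (scale (suc s) v) ≡ true
  divisibleᴹ-scale []      = refl
  divisibleᴹ-scale (x ∷ v) = cong₂ _∧_
    (dec-true (suc s ℕ.* x ℕ.% suc s ℕₚ.≟ 0) (trans (cong (ℕ._% suc s) (ℕₚ.*-comm (suc s) x)) (ℕ.m*n%n≡0 x (suc s))))
    (divisibleᴹ-scale v)

  divideᴹ-≤ᴹ : ∀ β → divideᴹ β ≤ᴹ β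
  divideᴹ-≤ᴹ []      = []
  divideᴹ-≤ᴹ (e ∷ β) = ℕ.m/n≤m e (suc s) ∷ divideᴹ-≤ᴹ β

⊕-≟ᴹ-split : ∀ w y x → length w ≡ length y → does (w ⊕ y ≟ᴹ x) ≡ does (w ≤ᴹ? x) ∧ does (y ≟ᴹ x ⊖ w)
⊕-≟ᴹ-split w y x length-w≡length-y =
  does-⇔ (mk⇔ (split w y length-w≡length-y) (λ { (w≤x , refl) → ⊕-⊖ w≤x })) (w ⊕ y ≟ᴹ x) (w ≤ᴹ? x ×-dec y ≟ᴹ x ⊖ w)
  where
  split : ∀ w y {x} → length w ≡ length y → w ⊕ y ≡ x → w ≤ᴹ x × y ≡ x ⊖ w
  split []      []      _   refl = [] , refl
  split (a ∷ w) (b ∷ y) len refl with split w y (ℕₚ.suc-injective len) refl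
  ... | w≤ , y≡ = ℕₚ.m≤m+n a b ∷ w≤ , cong₂ _∷_ (sym (ℕₚ.m+n∸m≡n a b)) y≡

tx^ : Mono → Mono
tx^ α = deg α ∷ α

scale-tx^ : ∀ j α → scale j (tx^ α) ≡ tx^ (scale j α)
scale-tx^ j α = cong (_∷ scale j α) (sym (deg-scale j α))

tx^-≤ᴹ? : ∀ w x → does (tx^ w ≤ᴹ? tx^ x) ≡ does (w ≤ᴹ? x)
tx^-≤ᴹ? w x = does-⇔ (mk⇔ (λ { (_ ∷ w≤x) → w≤x }) (λ w≤x → ≤ᴹ⇒deg≤ w≤x ∷ w≤x)) (tx^ w ≤ᴹ? tx^ x) (w ≤ᴹ? x)

tx^-⊖ : ∀ {w x} → w ≤ᴹ x → tx^ x ⊖ tx^ w ≡ tx^ (x ⊖ w)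
tx^-⊖ {w} {x} w≤x = cong (_∷ x ⊖ w) (trans (cong (_∸ deg w) (sym (deg-⊖ w≤x))) (ℕₚ.m+n∸m≡n (deg w) (deg (x ⊖ w))))

mulS-∷ : ∀ A B e γ → mulS A B (e ∷ γ) ≡ ∑[ a < suc e ] mulS (λ r → A (a ∷ r)) (λ r → B (e ∸ a ∷ r)) γ
mulS-∷ A B e γ = ∑≤-cons e γ (λ β → A β * B ((e ∷ γ) ⊖ β))

mulS-cong : ∀ {A A′ B B′} → A ≗ A′ → B ≗ B′ → mulS A B ≗ mulS A′ B′
mulS-cong A≗A′ B≗B′ γ = ∑-cong (below γ) (λ β → cong₂ _*_ (A≗A′ β) (B≗B′ (γ ⊖ β)))

mulS-congˡ : ∀ {A A′} B → A ≗ A′ → mulS A B ≗ mulS A′ B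
mulS-congˡ B A≗A′ = mulS-cong {B = B} {B′ = B} A≗A′ (λ _ → refl)

mulS-congʳ : ∀ A {B B′} → B ≗ B′ → mulS A B ≗ mulS A B′
mulS-congʳ A B≗B′ = mulS-cong {A = A} {A′ = A} (λ _ → refl) B≗B′

mulS-comm : ∀ A B → mulS A B ≗ mulS B A
mulS-comm A B []      = cong (_+ 0ℚ) (*-comm (A []) (B []))
mulS-comm A B (e ∷ γ) = begin
  mulS A B (e ∷ γ)                                       ≡⟨ mulS-∷ A B e γ ⟩
  ∑[ a < suc e ] mulS (A′ a) (B′ (e ∸ a)) γ              ≡⟨ ∑<-cong (suc e) (λ a _ → mulS-comm (A′ a) (B′ (e ∸ a)) γ) ⟩
  ∑[ a < suc e ] mulS (B′ (e ∸ a)) (A′ a) γ              ≡⟨ ∑<-reverse (suc e) (λ a → mulS (B′ (e ∸ a)) (A′ a) γ) ⟨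
  ∑[ a < suc e ] mulS (B′ (e ∸ (e ∸ a))) (A′ (e ∸ a)) γ  ≡⟨ ∑<-cong (suc e) (λ a a<1+e →
                                                              cong (λ b → mulS (B′ b) (A′ (e ∸ a)) γ) (ℕₚ.m∸[m∸n]≡n (ℕₚ.≤-pred a<1+e))) ⟩
  ∑[ a < suc e ] mulS (B′ a) (A′ (e ∸ a)) γ              ≡⟨ mulS-∷ B A e γ ⟨
  mulS B A (e ∷ γ)                                       ∎
  where
  A′ B′ : ℕ → Series
  A′ a r = A (a ∷ r)
  B′ a r = B (a ∷ r)

mulS-∑ˡ : ∀ {X : Set} (xs : List X) (F : X → Series) B →
  mulS (λ β → ∑[ x ∈ xs ] F x β) B ≗ λ γ → ∑[ x ∈ xs ] mulS (F x) B γ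
mulS-∑ˡ xs F B γ = begin
  ∑[ β ≤ᴹ γ ] (∑[ x ∈ xs ] F x β * B (γ ⊖ β))  ≡⟨ ∑-cong (below γ) (λ β → *-distribʳ-∑ (B (γ ⊖ β)) xs (λ x → F x β)) ⟩
  ∑[ β ≤ᴹ γ ] ∑[ x ∈ xs ] (F x β * B (γ ⊖ β))  ≡⟨ ∑-comm (below γ) xs _ ⟩
  ∑[ x ∈ xs ] mulS (F x) B γ                   ∎

mulS-∑ʳ : ∀ {X : Set} (xs : List X) A (F : X → Series) →
  mulS A (λ β → ∑[ x ∈ xs ] F x β) ≗ λ γ → ∑[ x ∈ xs ] mulS A (F x) γ
mulS-∑ʳ xs A F γ = begin
  ∑[ β ≤ᴹ γ ] (A β * ∑[ x ∈ xs ] F x (γ ⊖ β))  ≡⟨ ∑-cong (below γ) (λ β → *-distribˡ-∑ (A β) xs (λ x → F x (γ ⊖ β))) ⟩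
  ∑[ β ≤ᴹ γ ] ∑[ x ∈ xs ] (A β * F x (γ ⊖ β))  ≡⟨ ∑-comm (below γ) xs _ ⟩
  ∑[ x ∈ xs ] mulS A (F x) γ                   ∎

mulS-*ʳ : ∀ c A B → mulS A (λ β → c * B β) ≗ λ γ → c * mulS A B γ
mulS-*ʳ c A B γ = trans (∑-cong (below γ) (λ β → swap (A β) c _)) (sym (*-distribˡ-∑ c (below γ) _))
  where
  swap : ∀ x c y → x * (c * y) ≡ c * (x * y)
  swap = solve 3 (λ x c y → x :* (c :* y) := c :* (x :* y)) refl

mulS-+ˡ : ∀ A A′ B → mulS (λ β → A β + A′ β) B ≗ λ γ → mulS A B γ + mulS A′ B γ
mulS-+ˡ A A′ B γ = trans (∑-cong (below γ) (λ β → *-distribʳ-+ _ (A β) (A′ β))) (∑-+ (below γ) _ _)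

mulS-zeroˡ : ∀ B → mulS (λ _ → 0ℚ) B ≗ λ _ → 0ℚ
mulS-zeroˡ B γ = trans (∑-cong (below γ) (λ β → *-zeroˡ (B (γ ⊖ β)))) (∑-zero (below γ))

mulS-zeroʳ : ∀ A → mulS A (λ _ → 0ℚ) ≗ λ _ → 0ℚ
mulS-zeroʳ A γ = trans (∑-cong (below γ) (λ β → *-zeroʳ (A β))) (∑-zero (below γ))

mulS-assoc : ∀ A B C → mulS (mulS A B) C ≗ mulS A (mulS B C)
mulS-assoc A B C []      = assoc (A []) (B []) (C [])
  where
  assoc : ∀ a b c → (a * b + 0ℚ) * c + 0ℚ ≡ a * (b * c + 0ℚ) + 0ℚ
  assoc = solve 3 (λ a b c → (a :* b :+ con 0ℚ) :* c :+ con 0ℚ := a :* (b :* c :+ con 0ℚ) :+ con 0ℚ) refl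
mulS-assoc A B C (e ∷ γ) = begin
  mulS (mulS A B) C (e ∷ γ)
    ≡⟨ mulS-∷ (mulS A B) C e γ ⟩
  ∑[ b < suc e ] mulS (λ r → mulS A B (b ∷ r)) (C′ (e ∸ b)) γ
    ≡⟨ ∑<-cong (suc e) (λ b _ → mulS-congˡ (C′ (e ∸ b)) (mulS-∷ A B b) γ) ⟩
  ∑[ b < suc e ] mulS (λ r → ∑[ d < suc b ] mulS (A′ d) (B′ (b ∸ d)) r) (C′ (e ∸ b)) γ
    ≡⟨ ∑<-cong (suc e) (λ b _ → mulS-∑ˡ (upTo (suc b)) (λ d → mulS (A′ d) (B′ (b ∸ d))) (C′ (e ∸ b)) γ) ⟩
  ∑[ b < suc e ] ∑[ d < suc b ] mulS (mulS (A′ d) (B′ (b ∸ d))) (C′ (e ∸ b)) γ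
    ≡⟨ ∑<-cong (suc e) (λ b _ → ∑<-cong (suc b) (λ d _ → mulS-assoc (A′ d) (B′ (b ∸ d)) (C′ (e ∸ b)) γ)) ⟩
  ∑[ b < suc e ] ∑[ d < suc b ] mulS (A′ d) (mulS (B′ (b ∸ d)) (C′ (e ∸ b))) γ
    ≡⟨ ∑<-triangle e (λ d b → mulS (A′ d) (mulS (B′ (b ∸ d)) (C′ (e ∸ b))) γ) ⟩
  ∑[ d < suc e ] ∑[ k < suc (e ∸ d) ] mulS (A′ d) (mulS (B′ (d ℕ.+ k ∸ d)) (C′ (e ∸ (d ℕ.+ k)))) γ
    ≡⟨ ∑<-cong (suc e) (λ d _ → ∑<-cong (suc (e ∸ d)) (λ k _ →
         cong₂ (λ i j → mulS (A′ d) (mulS (B′ i) (C′ j)) γ) (ℕₚ.m+n∸m≡n d k) (sym (ℕₚ.∸-+-assoc e d k)))) ⟩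
  ∑[ d < suc e ] ∑[ k < suc (e ∸ d) ] mulS (A′ d) (mulS (B′ k) (C′ (e ∸ d ∸ k))) γ
    ≡⟨ ∑<-cong (suc e) (λ d _ → mulS-∑ʳ (upTo (suc (e ∸ d))) (A′ d) (λ k → mulS (B′ k) (C′ (e ∸ d ∸ k))) γ) ⟨
  ∑[ d < suc e ] mulS (A′ d) (λ r → ∑[ k < suc (e ∸ d) ] mulS (B′ k) (C′ (e ∸ d ∸ k)) r) γ
    ≡⟨ ∑<-cong (suc e) (λ d _ → mulS-congʳ (A′ d) (mulS-∷ B C (e ∸ d)) γ) ⟨
  ∑[ d < suc e ] mulS (A′ d) (λ r → mulS B C (e ∸ d ∷ r)) γ
    ≡⟨ mulS-∷ A (mulS B C) e γ ⟨
  mulS A (mulS B C) (e ∷ γ) ∎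
  where
  A′ B′ C′ : ℕ → Series
  A′ a r = A (a ∷ r)
  B′ a r = B (a ∷ r)
  C′ a r = C (a ∷ r)

-- Exponentials via the Euler derivation

-- ∂ = Σ_v v ∂/∂v, summed over all variables v, t included.
∂ : Series → Series
∂ A γ = ℕtoℚ (deg γ) * A γ

∂-oneS : ∂ oneS ≗ λ _ → 0ℚ
∂-oneS γ with isOne γ in γ-isOne
... | true  = trans (cong (λ n → ℕtoℚ n * 1ℚ) (isOne⇒deg≡0 γ γ-isOne)) (*-zeroˡ 1ℚ)
... | false = *-zeroʳ (ℕtoℚ (deg γ))

∂-mulS : ∀ A B → ∂ (mulS A B) ≗ λ γ → mulS (∂ A) B γ + mulS A (∂ B) γ
∂-mulS A B γ = begin
  ℕtoℚ (deg γ) * ∑[ β ≤ᴹ γ ] (A β * B (γ ⊖ β))         ≡⟨ *-distribˡ-∑ (ℕtoℚ (deg γ)) (below γ) _ ⟩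
  ∑[ β ≤ᴹ γ ] (ℕtoℚ (deg γ) * (A β * B (γ ⊖ β)))       ≡⟨ ∑≤-cong γ leibniz ⟩
  ∑[ β ≤ᴹ γ ] (∂ A β * B (γ ⊖ β) + A β * ∂ B (γ ⊖ β))  ≡⟨ ∑-+ (below γ) _ _ ⟩
  mulS (∂ A) B γ + mulS A (∂ B) γ                      ∎
  where
  distrib : ∀ p q a b → (p + q) * (a * b) ≡ p * a * b + a * (q * b)
  distrib = solve 4 (λ p q a b → (p :+ q) :* (a :* b) := p :* a :* b :+ a :* (q :* b)) refl
  leibniz : ∀ β → β ≤ᴹ γ → ℕtoℚ (deg γ) * (A β * B (γ ⊖ β)) ≡ ∂ A β * B (γ ⊖ β) + A β * ∂ B (γ ⊖ β)
  leibniz β β≤γ = begin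
    ℕtoℚ (deg γ) * (A β * B (γ ⊖ β))                         ≡⟨ cong (λ n → ℕtoℚ n * (A β * B (γ ⊖ β))) (deg-⊖ β≤γ) ⟨
    ℕtoℚ (deg β ℕ.+ deg (γ ⊖ β)) * (A β * B (γ ⊖ β))         ≡⟨ cong (_* (A β * B (γ ⊖ β))) (ℕtoℚ-+ (deg β) (deg (γ ⊖ β))) ⟩
    (ℕtoℚ (deg β) + ℕtoℚ (deg (γ ⊖ β))) * (A β * B (γ ⊖ β))  ≡⟨ distrib (ℕtoℚ (deg β)) (ℕtoℚ (deg (γ ⊖ β))) (A β) (B (γ ⊖ β)) ⟩
    ∂ A β * B (γ ⊖ β) + A β * ∂ B (γ ⊖ β)                    ∎

∂-powS : ∀ G j → ∂ (powS G (suc j)) ≗ λ γ → ℕtoℚ (suc j) * mulS (∂ G) (powS G j) γ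
∂-powS G zero γ = begin
  ∂ (mulS G oneS) γ                      ≡⟨ ∂-mulS G oneS γ ⟩
  mulS (∂ G) oneS γ + mulS G (∂ oneS) γ  ≡⟨ cong (mulS (∂ G) oneS γ +_) (trans (mulS-congʳ G ∂-oneS γ) (mulS-zeroʳ G γ)) ⟩
  mulS (∂ G) oneS γ + 0ℚ                 ≡⟨ +-identityʳ _ ⟩
  mulS (∂ G) oneS γ                      ≡⟨ *-identityˡ _ ⟨
  1ℚ * mulS (∂ G) oneS γ                 ∎
∂-powS G (suc j) γ = begin
  ∂ (mulS G P) γ                                       ≡⟨ ∂-mulS G P γ ⟩
  mulS (∂ G) P γ + mulS G (∂ P) γ                      ≡⟨ cong (mulS (∂ G) P γ +_) G-∂P ⟩
  mulS (∂ G) P γ + ℕtoℚ (suc j) * mulS (∂ G) P γ       ≡⟨ cong (_+ ℕtoℚ (suc j) * mulS (∂ G) P γ) (*-identityˡ (mulS (∂ G) P γ)) ⟨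
  1ℚ * mulS (∂ G) P γ + ℕtoℚ (suc j) * mulS (∂ G) P γ  ≡⟨ *-distribʳ-+ (mulS (∂ G) P γ) 1ℚ (ℕtoℚ (suc j)) ⟨
  (1ℚ + ℕtoℚ (suc j)) * mulS (∂ G) P γ                 ≡⟨ cong (_* mulS (∂ G) P γ) (ℕtoℚ-+ 1 (suc j)) ⟨
  ℕtoℚ (suc (suc j)) * mulS (∂ G) P γ                  ∎
  where
  P Pⱼ : Series
  P  = powS G (suc j)
  Pⱼ = powS G j
  G-∂P : mulS G (∂ P) γ ≡ ℕtoℚ (suc j) * mulS (∂ G) P γ
  G-∂P = begin
    mulS G (∂ P) γ                                   ≡⟨ mulS-congʳ G (∂-powS G j) γ ⟩
    mulS G (λ β → ℕtoℚ (suc j) * mulS (∂ G) Pⱼ β) γ  ≡⟨ mulS-*ʳ (ℕtoℚ (suc j)) G (mulS (∂ G) Pⱼ) γ ⟩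
    ℕtoℚ (suc j) * mulS G (mulS (∂ G) Pⱼ) γ          ≡⟨ cong (ℕtoℚ (suc j) *_) (mulS-assoc G (∂ G) Pⱼ γ) ⟨
    ℕtoℚ (suc j) * mulS (mulS G (∂ G)) Pⱼ γ          ≡⟨ cong (ℕtoℚ (suc j) *_) (mulS-congˡ Pⱼ (mulS-comm G (∂ G)) γ) ⟩
    ℕtoℚ (suc j) * mulS (mulS (∂ G) G) Pⱼ γ          ≡⟨ cong (ℕtoℚ (suc j) *_) (mulS-assoc (∂ G) G Pⱼ γ) ⟩
    ℕtoℚ (suc j) * mulS (∂ G) P γ                    ∎

∂-deg≡0 : ∀ A {β} → deg β ≡ 0 → ∂ A β ≡ 0ℚ
∂-deg≡0 A {β} deg-β≡0 = trans (cong (λ n → ℕtoℚ n * A β) deg-β≡0) (*-zeroˡ (A β))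

NoConstantTerm : Series → Set
NoConstantTerm G = ∀ β → deg β ≡ 0 → G β ≡ 0ℚ

SolvesExpODE : Series → Series → Set
SolvesExpODE G F = ∂ F ≗ mulS (∂ G) F

powS-vanishes : ∀ {G} → NoConstantTerm G → ∀ j γ → deg γ < j → powS G j γ ≡ 0ℚ
powS-vanishes {G} G₀ (suc j) γ deg-γ<1+j = ∑≤-zero γ term
  where
  term : ∀ β → β ≤ᴹ γ → G β * powS G j (γ ⊖ β) ≡ 0ℚ
  term β β≤γ with deg β ℕₚ.≟ 0
  ... | yes deg-β≡0 = trans (cong (_* powS G j (γ ⊖ β)) (G₀ β deg-β≡0)) (*-zeroˡ (powS G j (γ ⊖ β)))
  ... | no  deg-β≢0 = trans (cong (G β *_) (powS-vanishes G₀ j (γ ⊖ β)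
                              (ℕₚ.<-≤-trans (deg-⊖< β≤γ deg-β≢0) (ℕₚ.≤-pred deg-γ<1+j)))) (*-zeroʳ (G β))

expS-deg≡0 : ∀ G γ → deg γ ≡ 0 → expS G γ ≡ 1ℚ
expS-deg≡0 G γ deg-γ≡0 rewrite deg-γ≡0 | deg≡0⇒isOne γ deg-γ≡0 = refl

expS-solvesExpODE : ∀ {G} → NoConstantTerm G → SolvesExpODE G (expS G)
expS-solvesExpODE {G} G₀ γ = begin
  ℕtoℚ d * ∑[ j < suc d ] (P j γ * 1/! j)                                        ≡⟨ *-distribˡ-∑ (ℕtoℚ d) (upTo (suc d)) _ ⟩
  ∑[ j < suc d ] (ℕtoℚ d * (P j γ * 1/! j))                                      ≡⟨ ∑<-suc d (λ j → ℕtoℚ d * (P j γ * 1/! j)) ⟩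
  ℕtoℚ d * (oneS γ * 1/! 0) + ∑[ j < d ] (ℕtoℚ d * (P (suc j) γ * 1/! (suc j)))  ≡⟨ cong₂ _+_ constant-term (∑<-cong d (λ j _ → term j)) ⟩
  0ℚ + ∑[ j < d ] mulS (∂ G) (λ β → P j β * 1/! j) γ                             ≡⟨ +-identityˡ _ ⟩
  ∑[ j < d ] mulS (∂ G) (λ β → P j β * 1/! j) γ                                  ≡⟨ mulS-∑ʳ (upTo d) (∂ G) (λ j β → P j β * 1/! j) γ ⟨
  mulS (∂ G) (λ β → ∑[ j < d ] (P j β * 1/! j)) γ                                ≡⟨ ∑≤-cong γ truncate ⟩
  mulS (∂ G) (expS G) γ                                                          ∎
  where
  d : ℕ
  d = deg γ
  P : ℕ → Series
  P = powS G
  constant-term : ℕtoℚ d * (oneS γ * 1/! 0) ≡ 0ℚ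
  constant-term = trans (sym (*-assoc (ℕtoℚ d) (oneS γ) (1/! 0))) (trans (cong (_* 1/! 0) (∂-oneS γ)) (*-zeroˡ (1/! 0)))
  rearrange : ∀ a b c → a * b * c ≡ b * (a * c)
  rearrange = solve 3 (λ a b c → a :* b :* c := b :* (a :* c)) refl
  term : ∀ j → ℕtoℚ d * (P (suc j) γ * 1/! (suc j)) ≡ mulS (∂ G) (λ β → P j β * 1/! j) γ
  term j = begin
    ℕtoℚ d * (P (suc j) γ * 1/! (suc j))               ≡⟨ *-assoc (ℕtoℚ d) (P (suc j) γ) (1/! (suc j)) ⟨
    ∂ (P (suc j)) γ * 1/! (suc j)                      ≡⟨ cong (_* 1/! (suc j)) (∂-powS G j γ) ⟩
    ℕtoℚ (suc j) * mulS (∂ G) (P j) γ * 1/! (suc j)    ≡⟨ rearrange (ℕtoℚ (suc j)) (mulS (∂ G) (P j) γ) (1/! (suc j)) ⟩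
    mulS (∂ G) (P j) γ * (ℕtoℚ (suc j) * 1/! (suc j))  ≡⟨ cong (mulS (∂ G) (P j) γ *_) (ℕtoℚ-*-1/!-suc j) ⟩
    mulS (∂ G) (P j) γ * 1/! j                         ≡⟨ *-comm (mulS (∂ G) (P j) γ) (1/! j) ⟩
    1/! j * mulS (∂ G) (P j) γ                         ≡⟨ mulS-*ʳ (1/! j) (∂ G) (P j) γ ⟨
    mulS (∂ G) (λ β → 1/! j * P j β) γ                 ≡⟨ mulS-congʳ (∂ G) (λ β → *-comm (1/! j) (P j β)) γ ⟩
    mulS (∂ G) (λ β → P j β * 1/! j) γ                 ∎
  truncate : ∀ β → β ≤ᴹ γ → ∂ G β * ∑[ j < d ] (P j (γ ⊖ β) * 1/! j) ≡ ∂ G β * expS G (γ ⊖ β)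
  truncate β β≤γ with deg β ℕₚ.≟ 0
  ... | yes deg-β≡0 = trans (annihilate _) (sym (annihilate _))
    where
    annihilate : ∀ X → ∂ G β * X ≡ 0ℚ
    annihilate X = trans (cong (_* X) (∂-deg≡0 G {β} deg-β≡0)) (*-zeroˡ X)
  ... | no  deg-β≢0 = cong (∂ G β *_) (∑<-extend (λ j → P j (γ ⊖ β) * 1/! j) (deg-⊖< β≤γ deg-β≢0)
                        (λ j deg<j _ → trans (cong (_* 1/! j) (powS-vanishes G₀ j (γ ⊖ β) deg<j)) (*-zeroˡ (1/! j))))

oneS-solvesExpODE : SolvesExpODE (λ _ → 0ℚ) oneS
oneS-solvesExpODE γ = trans (∂-oneS γ) (sym (trans (mulS-congˡ oneS (λ β → *-zeroʳ (ℕtoℚ (deg β))) γ) (mulS-zeroˡ oneS γ)))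

mulS-solvesExpODE : ∀ {G G′ F F′} → SolvesExpODE G F → SolvesExpODE G′ F′ →
  SolvesExpODE (λ β → G β + G′ β) (mulS F F′)
mulS-solvesExpODE {G} {G′} {F} {F′} odeF odeF′ γ = begin
  ∂ (mulS F F′) γ                                       ≡⟨ ∂-mulS F F′ γ ⟩
  mulS (∂ F) F′ γ + mulS F (∂ F′) γ                     ≡⟨ cong₂ _+_ (mulS-congˡ F′ odeF γ) (mulS-congʳ F odeF′ γ) ⟩
  mulS (mulS (∂ G) F) F′ γ + mulS F (mulS (∂ G′) F′) γ  ≡⟨ cong₂ _+_ (mulS-assoc (∂ G) F F′ γ) commute-∂G′ ⟩
  mulS (∂ G) (mulS F F′) γ + mulS (∂ G′) (mulS F F′) γ  ≡⟨ mulS-+ˡ (∂ G) (∂ G′) (mulS F F′) γ ⟨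
  mulS (λ β → ∂ G β + ∂ G′ β) (mulS F F′) γ             ≡⟨ mulS-congˡ (mulS F F′) (λ β → *-distribˡ-+ (ℕtoℚ (deg β)) (G β) (G′ β)) γ ⟨
  mulS (∂ (λ β → G β + G′ β)) (mulS F F′) γ             ∎
  where
  commute-∂G′ : mulS F (mulS (∂ G′) F′) γ ≡ mulS (∂ G′) (mulS F F′) γ
  commute-∂G′ = begin
    mulS F (mulS (∂ G′) F′) γ  ≡⟨ mulS-assoc F (∂ G′) F′ γ ⟨
    mulS (mulS F (∂ G′)) F′ γ  ≡⟨ mulS-congˡ F′ (mulS-comm F (∂ G′)) γ ⟩
    mulS (mulS (∂ G′) F) F′ γ  ≡⟨ mulS-assoc (∂ G′) F F′ γ ⟩
    mulS (∂ G′) (mulS F F′) γ  ∎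

-- At γ, ∂F = ∂G · F expresses deg γ · F γ through coefficients of F of smaller degree, as ∂G has no
-- constant term.
solvesExpODE-unique : ∀ {G G′ F F′} γ₀ → SolvesExpODE G F → SolvesExpODE G′ F′ →
  (∀ β → β ≤ᴹ γ₀ → G β ≡ G′ β) → (∀ γ → γ ≤ᴹ γ₀ → deg γ ≡ 0 → F γ ≡ F′ γ) →
  ∀ γ → γ ≤ᴹ γ₀ → F γ ≡ F′ γ
solvesExpODE-unique {G} {G′} {F} {F′} γ₀ odeF odeF′ G≡G′ F≡F′-on-constants γ =
  by-degree (suc (deg γ)) γ ℕₚ.≤-refl
  where
  by-degree : ∀ n γ → deg γ < n → γ ≤ᴹ γ₀ → F γ ≡ F′ γ
  by-degree (suc n) γ deg-γ<1+n γ≤γ₀ with deg γ ℕₚ.≟ 0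
  ... | yes deg-γ≡0 = F≡F′-on-constants γ γ≤γ₀ deg-γ≡0
  ... | no  deg-γ≢0 = ℕtoℚ-*-cancelˡ (deg γ) {{ℕ.≢-nonZero deg-γ≢0}} (begin
    ∂ F γ             ≡⟨ odeF γ ⟩
    mulS (∂ G) F γ    ≡⟨ ∑≤-cong γ term ⟩
    mulS (∂ G′) F′ γ  ≡⟨ odeF′ γ ⟨
    ∂ F′ γ            ∎)
    where
    term : ∀ β → β ≤ᴹ γ → ∂ G β * F (γ ⊖ β) ≡ ∂ G′ β * F′ (γ ⊖ β)
    term β β≤γ with deg β ℕₚ.≟ 0
    ... | yes deg-β≡0 = trans (cong (_* F (γ ⊖ β)) (∂-deg≡0 G {β} deg-β≡0))
                        (trans (*-zeroˡ (F (γ ⊖ β))) (sym (trans (cong (_* F′ (γ ⊖ β)) (∂-deg≡0 G′ {β} deg-β≡0)) (*-zeroˡ (F′ (γ ⊖ β))))))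
    ... | no  deg-β≢0 = cong₂ _*_ (cong (ℕtoℚ (deg β) *_) (G≡G′ β (≤ᴹ-trans β≤γ γ≤γ₀)))
                          (by-degree n (γ ⊖ β) (ℕₚ.<-≤-trans (deg-⊖< β≤γ deg-β≢0) (ℕₚ.≤-pred deg-γ<1+n)) (≤ᴹ-trans (⊖-≤ᴹ β≤γ) γ≤γ₀))

-- Negative binomial series

rising : ℚ → ℕ → ℚ
rising c J = prodℚ (map (λ i → c + ℕtoℚ i) (upTo J))

rising-suc : ∀ c J → rising c (suc J) ≡ rising c J * (c + ℕtoℚ J)
rising-suc c J = begin
  prodℚ (map f (upTo (suc J)))        ≡⟨ cong (prodℚ ∘ map f) (List.upTo-∷ʳ J) ⟨
  prodℚ (map f (upTo J ++ J ∷ []))    ≡⟨ cong prodℚ (List.map-++ f (upTo J) (J ∷ [])) ⟩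
  prodℚ (map f (upTo J) ++ f J ∷ [])  ≡⟨ prodℚ-++ (map f (upTo J)) (f J ∷ []) ⟩
  rising c J * (f J * 1ℚ)             ≡⟨ cong (rising c J *_) (*-identityʳ (f J)) ⟩
  rising c J * f J                    ∎
  where
  f : ℕ → ℚ
  f i = c + ℕtoℚ i
  prodℚ-++ : ∀ xs ys → prodℚ (xs ++ ys) ≡ prodℚ xs * prodℚ ys
  prodℚ-++ []       ys = sym (*-identityˡ _)
  prodℚ-++ (x ∷ xs) ys = trans (cong (x *_) (prodℚ-++ xs ys)) (sym (*-assoc x _ _))

-- Coefficientwise form of ∂(1 − x)^{−c} = c x (1 − x)^{−1} · (1 − x)^{−c}.
multichoose-recurrence : ∀ c J → ℕtoℚ J * multichoose c J ≡ c * ∑< J (multichoose c)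
multichoose-recurrence c zero    = trans (*-zeroˡ (multichoose c 0)) (sym (*-zeroʳ c))
multichoose-recurrence c (suc J) = begin
  ℕtoℚ (suc J) * (rising c (suc J) * 1/! (suc J))
    ≡⟨ cong (λ x → ℕtoℚ (suc J) * (x * 1/! (suc J))) (rising-suc c J) ⟩
  ℕtoℚ (suc J) * (rising c J * (c + ℕtoℚ J) * 1/! (suc J))
    ≡⟨ shuffle (ℕtoℚ (suc J)) (rising c J * (c + ℕtoℚ J)) (1/! (suc J)) ⟩
  rising c J * (c + ℕtoℚ J) * (ℕtoℚ (suc J) * 1/! (suc J))
    ≡⟨ cong (rising c J * (c + ℕtoℚ J) *_) (ℕtoℚ-*-1/!-suc J) ⟩
  rising c J * (c + ℕtoℚ J) * 1/! J
    ≡⟨ expand (rising c J) c (ℕtoℚ J) (1/! J) ⟩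
  c * multichoose c J + ℕtoℚ J * multichoose c J
    ≡⟨ cong (c * multichoose c J +_) (multichoose-recurrence c J) ⟩
  c * multichoose c J + c * ∑< J (multichoose c)
    ≡⟨ *-distribˡ-+ c _ _ ⟨
  c * (multichoose c J + ∑< J (multichoose c))
    ≡⟨ cong (c *_) (trans (+-comm (multichoose c J) _) (sym (∑<-sucʳ J (multichoose c)))) ⟩
  c * ∑< (suc J) (multichoose c) ∎
  where
  shuffle : ∀ a b i → a * (b * i) ≡ b * (a * i)
  shuffle = solve 3 (λ a b i → a :* (b :* i) := b :* (a :* i)) refl
  expand : ∀ p c n i → p * (c + n) * i ≡ c * (p * i) + n * (p * i)
  expand = solve 4 (λ p c n i → p :* (c :+ n) :* i := c :* (p :* i) :+ n :* (p :* i)) refl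

-- (1 − x^v)^{−c} and its logarithm −c log(1 − x^v).
negBinomial : ℚ → Mono → Series
negBinomial c v β = ∑[ J < suc (deg β) ] (if does (β ≟ᴹ scale J v) then multichoose c J else 0ℚ)

negBinomialLog : ℚ → Mono → Series
negBinomialLog c v β = ∑[ k < deg β ] (if does (β ≟ᴹ scale (suc k) v) then c * 1/ℕ (suc k) else 0ℚ)

module _ (v : Mono) (c : ℚ) where

  negBinomial-non-multiple : ∀ γ → (∀ j → γ ≢ scale j v) → negBinomial c v γ ≡ 0ℚ
  negBinomial-non-multiple γ γ≢jv = ∑<-zero (suc (deg γ)) (λ j _ →
    cong (if_then multichoose c j else 0ℚ) (dec-false (γ ≟ᴹ scale j v) (γ≢jv j)))

  ∂negBinomialLog : ∀ β → ∂ (negBinomialLog c v) β ≡ ∑[ k < deg β ] (if does (β ≟ᴹ scale (suc k) v) then c * ℕtoℚ (deg v) else 0ℚ)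
  ∂negBinomialLog β = trans (*-distribˡ-∑ (ℕtoℚ (deg β)) (upTo (deg β)) _) (∑<-cong (deg β) (λ k _ → term k (β ≟ᴹ scale (suc k) v)))
    where
    term : ∀ k (β≟kv : Dec (β ≡ scale (suc k) v)) →
      ℕtoℚ (deg β) * (if does β≟kv then c * 1/ℕ (suc k) else 0ℚ) ≡ (if does β≟kv then c * ℕtoℚ (deg v) else 0ℚ)
    term k (no _)     = *-zeroʳ (ℕtoℚ (deg β))
    term k (yes refl) = begin
      ℕtoℚ (deg (scale (suc k) v)) * (c * 1/ℕ (suc k))  ≡⟨ cong (λ n → ℕtoℚ n * (c * 1/ℕ (suc k))) (deg-scale (suc k) v) ⟩
      ℕtoℚ (suc k ℕ.* deg v) * (c * 1/ℕ (suc k))        ≡⟨ cong (_* (c * 1/ℕ (suc k))) (ℕtoℚ-* (suc k) (deg v)) ⟩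
      ℕtoℚ (suc k) * ℕtoℚ (deg v) * (c * 1/ℕ (suc k))   ≡⟨ regroup (ℕtoℚ (suc k)) (ℕtoℚ (deg v)) c (1/ℕ (suc k)) ⟩
      1/ℕ (suc k) * ℕtoℚ (suc k) * (c * ℕtoℚ (deg v))   ≡⟨ cong (_* (c * ℕtoℚ (deg v))) (1/ℕ-inverseˡ k) ⟩
      1ℚ * (c * ℕtoℚ (deg v))                           ≡⟨ *-identityˡ _ ⟩
      c * ℕtoℚ (deg v)                                  ∎
      where
      regroup : ∀ a b c i → a * b * (c * i) ≡ i * a * (c * b)
      regroup = solve 4 (λ a b c i → a :* b :* (c :* i) := i :* a :* (c :* b)) refl

  negBinomial-deg≡0 : ∀ γ → deg γ ≡ 0 → length γ ≡ length v → negBinomial c v γ ≡ 1ℚ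
  negBinomial-deg≡0 γ deg-γ≡0 length-γ = begin
    negBinomial c v γ                                             ≡⟨ cong (λ n → ∑< (suc n) summand) deg-γ≡0 ⟩
    (if does (γ ≟ᴹ scale 0 v) then multichoose c 0 else 0ℚ) + 0ℚ  ≡⟨ cong (λ b → (if b then multichoose c 0 else 0ℚ) + 0ℚ)
                                                                        (dec-true (γ ≟ᴹ scale 0 v) γ≡0v) ⟩
    1ℚ                                                            ∎
    where
    summand : ℕ → ℚ
    summand J = if does (γ ≟ᴹ scale J v) then multichoose c J else 0ℚ
    γ≡0v : γ ≡ scale 0 v
    γ≡0v = deg≡0-unique γ (scale 0 v) deg-γ≡0 (deg-scale 0 v) (trans length-γ (sym (List.length-map (0 ℕ.*_) v)))

module _ (v : Mono) (deg-v≢0 : deg v ≢ 0) (c : ℚ) where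

  negBinomial-scale : ∀ J → negBinomial c v (scale J v) ≡ multichoose c J
  negBinomial-scale J = begin
    ∑[ j < suc d ] (if does (scale J v ≟ᴹ scale j v) then multichoose c j else 0ℚ)
      ≡⟨ ∑<-cong (suc d) (λ j _ → cong (if_then multichoose c j else 0ℚ) (same-test j)) ⟩
    ∑[ j < suc d ] (if does (j ℕₚ.≟ J) then multichoose c j else 0ℚ)
      ≡⟨ ∑<-δ d J (multichoose c) ⟩
    (if does (J ℕₚ.≤? d) then multichoose c J else 0ℚ)
      ≡⟨ cong (if_then multichoose c J else 0ℚ) (dec-true (J ℕₚ.≤? d) (≤-deg-scale v deg-v≢0 J)) ⟩
    multichoose c J ∎
    where
    d : ℕ
    d = deg (scale J v)
    same-test : ∀ j → does (scale J v ≟ᴹ scale j v) ≡ does (j ℕₚ.≟ J)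
    same-test j = does-⇔ (mk⇔ (sym ∘ scale-injective v deg-v≢0 J j) (cong (λ i → scale i v) ∘ sym)) (scale J v ≟ᴹ scale j v) (j ℕₚ.≟ J)

  ∂negBinomialLog-mulS : ∀ Y γ → mulS (∂ (negBinomialLog c v)) Y γ ≡
    ∑[ k < deg γ ] (if does (scale (suc k) v ≤ᴹ? γ) then c * ℕtoℚ (deg v) * Y (γ ⊖ scale (suc k) v) else 0ℚ)
  ∂negBinomialLog-mulS Y γ = begin
    ∑[ β ≤ᴹ γ ] (∂ (negBinomialLog c v) β * Y (γ ⊖ β))                 ≡⟨ ∑≤-cong γ expand ⟩
    ∑[ β ≤ᴹ γ ] ∑[ k < deg γ ] summand k β                             ≡⟨ ∑-comm (below γ) (upTo (deg γ)) (λ β k → summand k β) ⟩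
    ∑[ k < deg γ ] ∑[ β ≤ᴹ γ ] summand k β                             ≡⟨ ∑<-cong (deg γ) (λ k _ → ∑≤-δ γ (w k) (λ β → C * Y (γ ⊖ β))) ⟩
    ∑[ k < deg γ ] (if does (w k ≤ᴹ? γ) then C * Y (γ ⊖ w k) else 0ℚ)  ∎
    where
    C : ℚ
    C = c * ℕtoℚ (deg v)
    w : ℕ → Mono
    w k = scale (suc k) v
    summand : ℕ → Mono → ℚ
    summand k β = if does (β ≟ᴹ w k) then C * Y (γ ⊖ β) else 0ℚ
    expand : ∀ β → β ≤ᴹ γ → ∂ (negBinomialLog c v) β * Y (γ ⊖ β) ≡ ∑[ k < deg γ ] summand k β
    expand β β≤γ = begin
      ∂ (negBinomialLog c v) β * Y (γ ⊖ β)                              ≡⟨ cong (_* Y (γ ⊖ β)) (∂negBinomialLog v c β) ⟩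
      ∑[ k < deg β ] (if does (β ≟ᴹ w k) then C else 0ℚ) * Y (γ ⊖ β)    ≡⟨ *-distribʳ-∑ (Y (γ ⊖ β)) (upTo (deg β)) _ ⟩
      ∑[ k < deg β ] ((if does (β ≟ᴹ w k) then C else 0ℚ) * Y (γ ⊖ β))  ≡⟨ ∑<-cong (deg β) (λ k _ → if-*ʳ (does (β ≟ᴹ w k)) C (Y (γ ⊖ β))) ⟩
      ∑[ k < deg β ] summand k β                                        ≡⟨ ∑<-extend (λ k → summand k β) (≤ᴹ⇒deg≤ β≤γ) vanish ⟨
      ∑[ k < deg γ ] summand k β                                        ∎
      where
      vanish : ∀ k → deg β ≤ k → k < deg γ → summand k β ≡ 0ℚ
      vanish k deg-β≤k _ = cong (if_then C * Y (γ ⊖ β) else 0ℚ) (dec-false (β ≟ᴹ w k) λ β≡w →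
        ℕₚ.<⇒≱ (s≤s deg-β≤k) (subst (λ β → suc k ≤ deg β) (sym β≡w) (≤-deg-scale v deg-v≢0 (suc k))))

  negBinomial-solvesExpODE-scale : ∀ J → ∂ (negBinomial c v) (scale J v) ≡ mulS (∂ (negBinomialLog c v)) (negBinomial c v) (scale J v)
  negBinomial-solvesExpODE-scale J = begin
    ℕtoℚ (deg (scale J v)) * E (scale J v)       ≡⟨ cong₂ _*_ (trans (cong ℕtoℚ (deg-scale J v)) (ℕtoℚ-* J (deg v))) (negBinomial-scale J) ⟩
    ℕtoℚ J * ℕtoℚ (deg v) * multichoose c J      ≡⟨ regroup (ℕtoℚ J) (ℕtoℚ (deg v)) (multichoose c J) ⟩
    ℕtoℚ (deg v) * (ℕtoℚ J * multichoose c J)    ≡⟨ cong (ℕtoℚ (deg v) *_) (multichoose-recurrence c J) ⟩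
    ℕtoℚ (deg v) * (c * ∑< J (multichoose c))    ≡⟨ regroup′ (ℕtoℚ (deg v)) c (∑< J (multichoose c)) ⟩
    C * ∑< J (multichoose c)                     ≡⟨ cong (C *_) (∑<-reverse J (multichoose c)) ⟨
    C * ∑[ k < J ] multichoose c (J ∸ suc k)     ≡⟨ *-distribˡ-∑ C (upTo J) _ ⟩
    ∑[ k < J ] (C * multichoose c (J ∸ suc k))   ≡⟨ ∑<-cong J below-J ⟩
    ∑< J F                                       ≡⟨ ∑<-extend F (≤-deg-scale v deg-v≢0 J) beyond-J ⟨
    ∑< (deg (scale J v)) F                       ≡⟨ ∂negBinomialLog-mulS E (scale J v) ⟨
    mulS (∂ (negBinomialLog c v)) E (scale J v)  ∎
    where
    E : Series
    E = negBinomial c v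
    C : ℚ
    C = c * ℕtoℚ (deg v)
    regroup : ∀ a b x → a * b * x ≡ b * (a * x)
    regroup = solve 3 (λ a b x → a :* b :* x := b :* (a :* x)) refl
    regroup′ : ∀ a b x → a * (b * x) ≡ b * a * x
    regroup′ = solve 3 (λ a b x → a :* (b :* x) := b :* a :* x) refl
    F : ℕ → ℚ
    F k = if does (scale (suc k) v ≤ᴹ? scale J v) then C * E (scale J v ⊖ scale (suc k) v) else 0ℚ
    below-J : ∀ k → k < J → C * multichoose c (J ∸ suc k) ≡ F k
    below-J k k<J rewrite dec-true (scale (suc k) v ≤ᴹ? scale J v) (scale-mono v k<J) | scale-∸ J (suc k) v =
      cong (C *_) (sym (negBinomial-scale (J ∸ suc k)))
    beyond-J : ∀ k → J ≤ k → k < deg (scale J v) → F k ≡ 0ℚ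
    beyond-J k J≤k _ = cong (if_then C * E (scale J v ⊖ scale (suc k) v) else 0ℚ)
      (dec-false (scale (suc k) v ≤ᴹ? scale J v) (λ le → ℕₚ.<⇒≱ (s≤s J≤k) (scale-≤ᴹ-cancel v deg-v≢0 (suc k) J le)))

  negBinomial-solvesExpODE-non-multiple : ∀ γ → (∀ j → γ ≢ scale j v) →
    ∂ (negBinomial c v) γ ≡ mulS (∂ (negBinomialLog c v)) (negBinomial c v) γ
  negBinomial-solvesExpODE-non-multiple γ γ≢jv = begin
    ℕtoℚ (deg γ) * negBinomial c v γ                      ≡⟨ cong (ℕtoℚ (deg γ) *_) (negBinomial-non-multiple v c γ γ≢jv) ⟩
    ℕtoℚ (deg γ) * 0ℚ                                     ≡⟨ *-zeroʳ (ℕtoℚ (deg γ)) ⟩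
    0ℚ                                                    ≡⟨ ∑<-zero (deg γ) (λ k _ → term k (scale (suc k) v ≤ᴹ? γ)) ⟨
    ∑[ k < deg γ ] (if does (scale (suc k) v ≤ᴹ? γ) then C * negBinomial c v (γ ⊖ scale (suc k) v) else 0ℚ)
                                                          ≡⟨ ∂negBinomialLog-mulS (negBinomial c v) γ ⟨
    mulS (∂ (negBinomialLog c v)) (negBinomial c v) γ     ∎
    where
    C : ℚ
    C = c * ℕtoℚ (deg v)
    term : ∀ k (w≤?γ : Dec (scale (suc k) v ≤ᴹ γ)) →
      (if does w≤?γ then C * negBinomial c v (γ ⊖ scale (suc k) v) else 0ℚ) ≡ 0ℚ
    term k (no _)    = refl
    term k (yes w≤γ) = trans (cong (C *_) (negBinomial-non-multiple v c (γ ⊖ scale (suc k) v) rest≢jv)) (*-zeroʳ C)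
      where
      rest≢jv : ∀ j → γ ⊖ scale (suc k) v ≢ scale j v
      rest≢jv j rest≡jv = γ≢jv (suc k ℕ.+ j) (begin
        γ                                        ≡⟨ ⊕-⊖ w≤γ ⟨
        scale (suc k) v ⊕ (γ ⊖ scale (suc k) v)  ≡⟨ cong (scale (suc k) v ⊕_) rest≡jv ⟩
        scale (suc k) v ⊕ scale j v              ≡⟨ scale-+ (suc k) j v ⟩
        scale (suc k ℕ.+ j) v                    ∎)

  negBinomial-solvesExpODE : SolvesExpODE (negBinomialLog c v) (negBinomial c v)
  negBinomial-solvesExpODE γ with multiple? v deg-v≢0 γ
  ... | inj₁ (J , refl) = negBinomial-solvesExpODE-scale J
  ... | inj₂ γ≢jv      = negBinomial-solvesExpODE-non-multiple γ γ≢jv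

  negBinomial-truncate : ∀ B β → (∀ J → B < J → β ≢ scale J v) →
    negBinomial c v β ≡ ∑[ J < suc B ] (if does (β ≟ᴹ scale J v) then multichoose c J else 0ℚ)
  negBinomial-truncate B β β≢large = begin
    ∑< (suc (deg β)) summand
      ≡⟨ ∑<-extend summand (s≤s (ℕₚ.m≤n+m (deg β) B)) (vanish (deg β) (λ J deg-β<J → β≢large-by-degree J deg-β<J)) ⟨
    ∑< (suc (B ℕ.+ deg β)) summand
      ≡⟨ ∑<-extend summand (s≤s (ℕₚ.m≤m+n B (deg β))) (vanish B β≢large) ⟩
    ∑< (suc B) summand ∎
    where
    summand : ℕ → ℚ
    summand J = if does (β ≟ᴹ scale J v) then multichoose c J else 0ℚ
    β≢large-by-degree : ∀ J → deg β < J → β ≢ scale J v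
    β≢large-by-degree J deg-β<J β≡Jv = ℕₚ.<⇒≱ deg-β<J (subst (λ β → J ≤ deg β) (sym β≡Jv) (≤-deg-scale v deg-v≢0 J))
    vanish : ∀ n → (∀ J → n < J → β ≢ scale J v) → ∀ J → suc n ≤ J → J < suc (B ℕ.+ deg β) → summand J ≡ 0ℚ
    vanish n β≢ J n<J _ = cong (if_then multichoose c J else 0ℚ) (dec-false (β ≟ᴹ scale J v) (β≢ J n<J))

  mulS-negBinomial : ∀ B Y γ → (∀ J → B < J → ¬ scale J v ≤ᴹ γ) →
    mulS (negBinomial c v) Y γ ≡ ∑[ J < suc B ] (if does (scale J v ≤ᴹ? γ) then multichoose c J * Y (γ ⊖ scale J v) else 0ℚ)
  mulS-negBinomial B Y γ large≰γ = begin
    ∑[ β ≤ᴹ γ ] (negBinomial c v β * Y (γ ⊖ β))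
      ≡⟨ ∑≤-cong γ expand ⟩
    ∑[ β ≤ᴹ γ ] ∑[ J < suc B ] summand J β
      ≡⟨ ∑-comm (below γ) (upTo (suc B)) (λ β J → summand J β) ⟩
    ∑[ J < suc B ] ∑[ β ≤ᴹ γ ] summand J β
      ≡⟨ ∑<-cong (suc B) (λ J _ → ∑≤-δ γ (scale J v) (λ β → multichoose c J * Y (γ ⊖ β))) ⟩
    ∑[ J < suc B ] (if does (scale J v ≤ᴹ? γ) then multichoose c J * Y (γ ⊖ scale J v) else 0ℚ) ∎
    where
    summand : ℕ → Mono → ℚ
    summand J β = if does (β ≟ᴹ scale J v) then multichoose c J * Y (γ ⊖ β) else 0ℚ
    expand : ∀ β → β ≤ᴹ γ → negBinomial c v β * Y (γ ⊖ β) ≡ ∑[ J < suc B ] summand J β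
    expand β β≤γ = begin
      negBinomial c v β * Y (γ ⊖ β)
        ≡⟨ cong (_* Y (γ ⊖ β)) (negBinomial-truncate B β (λ J B<J β≡Jv → large≰γ J B<J (subst (_≤ᴹ γ) β≡Jv β≤γ))) ⟩
      ∑[ J < suc B ] (if does (β ≟ᴹ scale J v) then multichoose c J else 0ℚ) * Y (γ ⊖ β)
        ≡⟨ *-distribʳ-∑ (Y (γ ⊖ β)) (upTo (suc B)) (λ J → if does (β ≟ᴹ scale J v) then multichoose c J else 0ℚ) ⟩
      ∑[ J < suc B ] ((if does (β ≟ᴹ scale J v) then multichoose c J else 0ℚ) * Y (γ ⊖ β))
        ≡⟨ ∑<-cong (suc B) (λ J _ → if-*ʳ (does (β ≟ᴹ scale J v)) (multichoose c J) (Y (γ ⊖ β))) ⟩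
      ∑[ J < suc B ] summand J β ∎

-- Homogeneity and symmetry of Ω(Ω₀^{(m)}(tX))

Homogeneous : Series → Set
Homogeneous A = ∀ k x → k ≢ deg x → A (k ∷ x) ≡ 0ℚ

oneS-homogeneous : Homogeneous oneS
oneS-homogeneous k x k≢deg-x with isOne (k ∷ x) in kx-isOne
... | false = refl
... | true  = contradiction (trans (ℕₚ.m+n≡0⇒m≡0 k deg≡0) (sym (ℕₚ.m+n≡0⇒n≡0 k deg≡0))) k≢deg-x
  where
  deg≡0 : k ℕ.+ deg x ≡ 0
  deg≡0 = isOne⇒deg≡0 (k ∷ x) kx-isOne

h₁tX-homogeneous : Homogeneous h₁tX
h₁tX-homogeneous k x k≢deg-x = by-cases (k ℕₚ.≟ 1) (deg x ℕₚ.≟ 1)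
  where
  by-cases : (k≟1 : Dec (k ≡ 1)) (deg-x≟1 : Dec (deg x ≡ 1)) → (if does k≟1 ∧ does deg-x≟1 then 1ℚ else 0ℚ) ≡ 0ℚ
  by-cases (yes k≡1) (yes deg-x≡1) = contradiction (trans k≡1 (sym deg-x≡1)) k≢deg-x
  by-cases (yes _)   (no _)        = refl
  by-cases (no _)    _             = refl

−S-homogeneous : ∀ A B → Homogeneous A → Homogeneous B → Homogeneous (A −S B)
−S-homogeneous A B homA homB k x k≢deg-x = cong₂ _-_ (homA k x k≢deg-x) (homB k x k≢deg-x)

mulS-homogeneous : ∀ A B → Homogeneous A → Homogeneous B → Homogeneous (mulS A B)
mulS-homogeneous A B homA homB k x k≢deg-x = ∑≤-zero (k ∷ x) term
  where
  term : ∀ β → β ≤ᴹ k ∷ x → A β * B ((k ∷ x) ⊖ β) ≡ 0ℚ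
  term (a ∷ r) (a≤k ∷ r≤x) with a ℕₚ.≟ deg r
  ... | no  a≢deg-r = trans (cong (_* B ((k ∷ x) ⊖ (a ∷ r))) (homA a r a≢deg-r)) (*-zeroˡ (B ((k ∷ x) ⊖ (a ∷ r))))
  ... | yes refl    = trans (cong (A (a ∷ r) *_) (homB (k ∸ a) (x ⊖ r) rest≢)) (*-zeroʳ (A (a ∷ r)))
    where
    rest≢ : k ∸ a ≢ deg (x ⊖ r)
    rest≢ eq = k≢deg-x (trans (sym (ℕₚ.m+[n∸m]≡n a≤k)) (trans (cong (a ℕ.+_) eq) (deg-⊖ r≤x)))

powS-homogeneous : ∀ A → Homogeneous A → ∀ j → Homogeneous (powS A j)
powS-homogeneous A homA zero    = oneS-homogeneous
powS-homogeneous A homA (suc j) = mulS-homogeneous A (powS A j) homA (powS-homogeneous A homA j)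

pS-homogeneous : ∀ s A → Homogeneous A → Homogeneous (pS s A)
pS-homogeneous s A homA k x k≢deg-x with divisibleᴹ s (k ∷ x) in kx-divisible
... | false = refl
... | true  = homA (k ℕ./ suc s) (divideᴹ s x) λ k/≡deg-x/ → k≢deg-x (begin
  k                                  ≡⟨ proj₁ (List.∷-injective exact) ⟨
  suc s ℕ.* (k ℕ./ suc s)            ≡⟨ cong (suc s ℕ.*_) k/≡deg-x/ ⟩
  suc s ℕ.* deg (divideᴹ s x)        ≡⟨ deg-scale (suc s) (divideᴹ s x) ⟨
  deg (scale (suc s) (divideᴹ s x))  ≡⟨ cong deg (proj₂ (List.∷-injective exact)) ⟩
  deg x                              ∎)
  where
  exact : scale (suc s) (divideᴹ s (k ∷ x)) ≡ k ∷ x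
  exact = scale-divideᴹ s (k ∷ x) kx-divisible

psumS-homogeneous : ∀ A → Homogeneous A → Homogeneous (psumS A)
psumS-homogeneous A homA k x k≢deg-x = ∑<-zero (deg (k ∷ x)) (λ s _ →
  trans (cong (1/ℕ (suc s) *_) (pS-homogeneous s A homA k x k≢deg-x)) (*-zeroʳ (1/ℕ (suc s))))

expS-homogeneous : ∀ G → Homogeneous G → Homogeneous (expS G)
expS-homogeneous G homG k x k≢deg-x = ∑<-zero (suc (deg (k ∷ x))) (λ j _ →
  trans (cong (_* 1/! j) (powS-homogeneous G homG j k x k≢deg-x)) (*-zeroˡ (1/! j)))

Ω-homogeneous : ∀ A → Homogeneous A → Homogeneous (Ω A)
Ω-homogeneous A homA = expS-homogeneous (psumS A) (psumS-homogeneous A homA)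

Ω₀^-homogeneous : ∀ m → Homogeneous (Ω₀^ m)
Ω₀^-homogeneous zero    = h₁tX-homogeneous
Ω₀^-homogeneous (suc m) = −S-homogeneous (Ω (Ω₀^ m)) oneS (Ω-homogeneous (Ω₀^ m) (Ω₀^-homogeneous m)) oneS-homogeneous

BGen-homogeneous : ∀ m → Homogeneous (BGen m)
BGen-homogeneous m = Ω-homogeneous (Ω₀^ m) (Ω₀^-homogeneous m)

swapAt : ℕ → List ℕ → List ℕ
swapAt zero    (a ∷ b ∷ r) = b ∷ a ∷ r
swapAt (suc i) (x ∷ r)     = x ∷ swapAt i r
swapAt _       r           = r

Symmetric : Series → Set
Symmetric A = ∀ i γ → A (swapAt (suc i) γ) ≡ A γ

deg-swapAt : ∀ i γ → deg (swapAt i γ) ≡ deg γ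
deg-swapAt zero    (a ∷ b ∷ r) = swap-+ a b (deg r)
  where
  swap-+ : ∀ a b c → b ℕ.+ (a ℕ.+ c) ≡ a ℕ.+ (b ℕ.+ c)
  swap-+ = solve-∀
deg-swapAt zero    []          = refl
deg-swapAt zero    (_ ∷ [])    = refl
deg-swapAt (suc i) []          = refl
deg-swapAt (suc i) (x ∷ γ)     = cong (x ℕ.+_) (deg-swapAt i γ)

allᵇ-swapAt : ∀ (p : ℕ → Bool) i γ → allᵇ p (swapAt i γ) ≡ allᵇ p γ
allᵇ-swapAt p zero    (a ∷ b ∷ r) = trans (sym (Bool.∧-assoc (p b) (p a) _))
                                      (trans (cong (_∧ allᵇ p r) (Bool.∧-comm (p b) (p a))) (Bool.∧-assoc (p a) (p b) _))
allᵇ-swapAt p zero    []          = refl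
allᵇ-swapAt p zero    (_ ∷ [])    = refl
allᵇ-swapAt p (suc i) []          = refl
allᵇ-swapAt p (suc i) (x ∷ γ)     = cong (p x ∧_) (allᵇ-swapAt p i γ)

map-swapAt : ∀ (f : ℕ → ℕ) i γ → map f (swapAt i γ) ≡ swapAt i (map f γ)
map-swapAt f zero    (a ∷ b ∷ r) = refl
map-swapAt f zero    []          = refl
map-swapAt f zero    (_ ∷ [])    = refl
map-swapAt f (suc i) []          = refl
map-swapAt f (suc i) (x ∷ γ)     = cong (f x ∷_) (map-swapAt f i γ)

swapAt-⊖ : ∀ i {β γ} → β ≤ᴹ γ → swapAt i γ ⊖ swapAt i β ≡ swapAt i (γ ⊖ β)
swapAt-⊖ zero    []          = refl
swapAt-⊖ zero    (_ ∷ [])    = refl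
swapAt-⊖ zero    (_ ∷ _ ∷ _) = refl
swapAt-⊖ (suc i) []          = refl
swapAt-⊖ (suc i) (_ ∷ β≤γ)   = cong (_ ∷_) (swapAt-⊖ i β≤γ)

∑≤-swapAt : ∀ i γ (f : Mono → ℚ) → ∑≤ (swapAt i γ) f ≡ ∑[ β ≤ᴹ γ ] f (swapAt i β)
∑≤-swapAt zero    []          f = refl
∑≤-swapAt zero    (a ∷ [])    f = ∑≤-cong (a ∷ []) {f} {f ∘ swapAt zero} λ { (_ ∷ []) (_ ∷ []) → refl }
∑≤-swapAt zero    (a ∷ b ∷ r) f = begin
  ∑[ β ≤ᴹ b ∷ a ∷ r ] f β                                  ≡⟨ ∑≤-cons b (a ∷ r) f ⟩
  ∑[ x < suc b ] ∑[ ρ ≤ᴹ a ∷ r ] f (x ∷ ρ)                 ≡⟨ ∑<-cong (suc b) (λ x _ → ∑≤-cons a r (λ ρ → f (x ∷ ρ))) ⟩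
  ∑[ x < suc b ] ∑[ y < suc a ] ∑[ ρ ≤ᴹ r ] f (x ∷ y ∷ ρ)  ≡⟨ ∑-comm (upTo (suc b)) (upTo (suc a)) (λ x y → ∑[ ρ ≤ᴹ r ] f (x ∷ y ∷ ρ)) ⟩
  ∑[ y < suc a ] ∑[ x < suc b ] ∑[ ρ ≤ᴹ r ] f (x ∷ y ∷ ρ)  ≡⟨ ∑<-cong (suc a) (λ y _ → ∑≤-cons b r (λ ρ → f (swapAt zero (y ∷ ρ)))) ⟨
  ∑[ y < suc a ] ∑[ ρ ≤ᴹ b ∷ r ] f (swapAt zero (y ∷ ρ))   ≡⟨ ∑≤-cons a (b ∷ r) (f ∘ swapAt zero) ⟨
  ∑[ β ≤ᴹ a ∷ b ∷ r ] f (swapAt zero β)                    ∎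
∑≤-swapAt (suc i) []          f = refl
∑≤-swapAt (suc i) (e ∷ γ)     f = begin
  ∑[ β ≤ᴹ e ∷ swapAt i γ ] f β                   ≡⟨ ∑≤-cons e (swapAt i γ) f ⟩
  ∑[ a < suc e ] ∑[ ρ ≤ᴹ swapAt i γ ] f (a ∷ ρ)  ≡⟨ ∑<-cong (suc e) (λ a _ → ∑≤-swapAt i γ (λ ρ → f (a ∷ ρ))) ⟩
  ∑[ a < suc e ] ∑[ ρ ≤ᴹ γ ] f (a ∷ swapAt i ρ)  ≡⟨ ∑≤-cons e γ (f ∘ swapAt (suc i)) ⟨
  ∑[ β ≤ᴹ e ∷ γ ] f (swapAt (suc i) β)           ∎

mulS-symmetric : ∀ A B → Symmetric A → Symmetric B → Symmetric (mulS A B)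
mulS-symmetric A B symA symB i γ = begin
  ∑[ β ≤ᴹ σ γ ] (A β * B (σ γ ⊖ β))      ≡⟨ ∑≤-swapAt (suc i) γ (λ β → A β * B (σ γ ⊖ β)) ⟩
  ∑[ β ≤ᴹ γ ] (A (σ β) * B (σ γ ⊖ σ β))  ≡⟨ ∑≤-cong γ (λ β β≤γ → cong₂ _*_ (symA i β)
                                               (trans (cong B (swapAt-⊖ (suc i) β≤γ)) (symB i (γ ⊖ β)))) ⟩
  ∑[ β ≤ᴹ γ ] (A β * B (γ ⊖ β))          ∎
  where
  σ : Mono → Mono
  σ = swapAt (suc i)

oneS-symmetric : Symmetric oneS
oneS-symmetric i γ = cong (if_then 1ℚ else 0ℚ) (allᵇ-swapAt (ℕ._≡ᵇ 0) (suc i) γ)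

h₁tX-symmetric : Symmetric h₁tX
h₁tX-symmetric i []      = refl
h₁tX-symmetric i (a ∷ x) = cong (λ d → if (a ℕ.≡ᵇ 1) ∧ (d ℕ.≡ᵇ 1) then 1ℚ else 0ℚ) (deg-swapAt i x)

−S-symmetric : ∀ A B → Symmetric A → Symmetric B → Symmetric (A −S B)
−S-symmetric A B symA symB i γ = cong₂ _-_ (symA i γ) (symB i γ)

powS-symmetric : ∀ A → Symmetric A → ∀ j → Symmetric (powS A j)
powS-symmetric A symA zero    = oneS-symmetric
powS-symmetric A symA (suc j) = mulS-symmetric A (powS A j) symA (powS-symmetric A symA j)

pS-symmetric : ∀ s A → Symmetric A → Symmetric (pS s A)
pS-symmetric s A symA i γ
  rewrite allᵇ-swapAt (λ e → (e ℕ.% suc s) ℕ.≡ᵇ 0) (suc i) γ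
        | map-swapAt (ℕ._/ suc s) (suc i) γ
        | symA i (map (ℕ._/ suc s) γ) = refl

psumS-symmetric : ∀ A → Symmetric A → Symmetric (psumS A)
psumS-symmetric A symA i γ rewrite deg-swapAt (suc i) γ =
  ∑<-cong (deg γ) (λ s _ → cong (1/ℕ (suc s) *_) (pS-symmetric s A symA i γ))

expS-symmetric : ∀ G → Symmetric G → Symmetric (expS G)
expS-symmetric G symG i γ rewrite deg-swapAt (suc i) γ =
  ∑<-cong (suc (deg γ)) (λ j _ → cong (_* 1/! j) (powS-symmetric G symG j i γ))

Ω-symmetric : ∀ A → Symmetric A → Symmetric (Ω A)
Ω-symmetric A symA = expS-symmetric (psumS A) (psumS-symmetric A symA)

Ω₀^-symmetric : ∀ m → Symmetric (Ω₀^ m)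
Ω₀^-symmetric zero    = h₁tX-symmetric
Ω₀^-symmetric (suc m) = −S-symmetric (Ω (Ω₀^ m)) oneS (Ω-symmetric (Ω₀^ m) (Ω₀^-symmetric m)) oneS-symmetric

BGen-symmetric : ∀ m → Symmetric (BGen m)
BGen-symmetric m = Ω-symmetric (Ω₀^ m) (Ω₀^-symmetric m)

swapAt-++ : ∀ pre a b r → swapAt (length pre) (pre ++ a ∷ b ∷ r) ≡ pre ++ b ∷ a ∷ r
swapAt-++ []        a b r = refl
swapAt-++ (x ∷ pre) a b r = cong (x ∷_) (swapAt-++ pre a b r)

module _ (A : Series) (symA : Symmetric A) (k : ℕ) where

  private
    insertDesc-invariant : ∀ pre x ys → A (k ∷ pre ++ insertDesc x ys) ≡ A (k ∷ pre ++ x ∷ ys)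
    insertDesc-invariant pre x []       = refl
    insertDesc-invariant pre x (y ∷ ys) with y ≤ᵇ x
    ... | true  = refl
    ... | false = begin
      A (k ∷ pre ++ y ∷ insertDesc x ys)                     ≡⟨ cong (λ l → A (k ∷ l)) (List.++-assoc pre [ y ] (insertDesc x ys)) ⟨
      A (k ∷ (pre ++ [ y ]) ++ insertDesc x ys)              ≡⟨ insertDesc-invariant (pre ++ [ y ]) x ys ⟩
      A (k ∷ (pre ++ [ y ]) ++ x ∷ ys)                       ≡⟨ cong (λ l → A (k ∷ l)) (List.++-assoc pre [ y ] (x ∷ ys)) ⟩
      A (k ∷ pre ++ y ∷ x ∷ ys)                              ≡⟨ cong (λ l → A (k ∷ l)) (swapAt-++ pre x y ys) ⟨
      A (swapAt (suc (length pre)) (k ∷ pre ++ x ∷ y ∷ ys))  ≡⟨ symA (length pre) (k ∷ pre ++ x ∷ y ∷ ys) ⟩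
      A (k ∷ pre ++ x ∷ y ∷ ys)                              ∎

    sortDesc-invariant : ∀ pre α → A (k ∷ pre ++ sortDesc α) ≡ A (k ∷ pre ++ α)
    sortDesc-invariant pre []       = refl
    sortDesc-invariant pre (x ∷ xs) = begin
      A (k ∷ pre ++ insertDesc x (sortDesc xs))  ≡⟨ insertDesc-invariant pre x (sortDesc xs) ⟩
      A (k ∷ pre ++ x ∷ sortDesc xs)             ≡⟨ cong (λ l → A (k ∷ l)) (List.++-assoc pre [ x ] (sortDesc xs)) ⟨
      A (k ∷ (pre ++ [ x ]) ++ sortDesc xs)      ≡⟨ sortDesc-invariant (pre ++ [ x ]) xs ⟩
      A (k ∷ (pre ++ [ x ]) ++ xs)               ≡⟨ cong (λ l → A (k ∷ l)) (List.++-assoc pre [ x ] xs) ⟩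
      A (k ∷ pre ++ x ∷ xs)                      ∎

  symmetric-sortDesc : ∀ α → A (k ∷ sortDesc α) ≡ A (k ∷ α)
  symmetric-sortDesc = sortDesc-invariant []

deg-sortDesc : ∀ α → deg (sortDesc α) ≡ deg α
deg-sortDesc []       = refl
deg-sortDesc (x ∷ xs) = trans (deg-insertDesc x (sortDesc xs)) (cong (x ℕ.+_) (deg-sortDesc xs))
  where
  deg-insertDesc : ∀ x ys → deg (insertDesc x ys) ≡ x ℕ.+ deg ys
  deg-insertDesc x []       = refl
  deg-insertDesc x (y ∷ ys) with y ≤ᵇ x
  ... | true  = refl
  ... | false = trans (cong (y ℕ.+_) (deg-insertDesc x ys)) (swap-+ y x (deg ys))
    where
    swap-+ : ∀ a b c → a ℕ.+ (b ℕ.+ c) ≡ b ℕ.+ (a ℕ.+ c)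
    swap-+ = solve-∀

ρ≡BGen : ∀ m α → ρ m α ≡ BGen m (tx^ α)
ρ≡BGen m α = trans (cong (λ d → BGen m (d ∷ sortDesc α)) (deg-sortDesc α))
                   (symmetric-sortDesc (BGen m) (BGen-symmetric m) (deg α) α)

BGen−oneS-coefficient : ∀ m d δ →
  (BGen m −S oneS) (d ∷ δ) ≡ (if isOne δ then 0ℚ else (if does (d ℕₚ.≟ deg δ) then ρ m δ else 0ℚ))
BGen−oneS-coefficient m d δ = by-cases (isOne δ) refl
  where
  by-cases : ∀ b → isOne δ ≡ b →
    (BGen m −S oneS) (d ∷ δ) ≡ (if b then 0ℚ else (if does (d ℕₚ.≟ deg δ) then ρ m δ else 0ℚ))
  by-cases true  δ-isOne = constant-part d
    where
    constant-part : ∀ d → BGen m (d ∷ δ) - oneS (d ∷ δ) ≡ 0ℚ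
    constant-part zero    = begin
      BGen m (0 ∷ δ) - oneS (0 ∷ δ)
        ≡⟨ cong₂ _-_ (expS-deg≡0 (psumS (Ω₀^ m)) (0 ∷ δ) (isOne⇒deg≡0 δ δ-isOne)) (cong (if_then 1ℚ else 0ℚ) δ-isOne) ⟩
      1ℚ - 1ℚ
        ≡⟨ +-inverseʳ 1ℚ ⟩
      0ℚ ∎
    constant-part (suc d) = cong (_- 0ℚ) (BGen-homogeneous m (suc d) δ λ 1+d≡deg-δ →
      ℕₚ.1+n≢0 (trans 1+d≡deg-δ (isOne⇒deg≡0 δ δ-isOne)))
  by-cases false δ-isOne = begin
    BGen m (d ∷ δ) - oneS (d ∷ δ)
      ≡⟨ cong (λ b → BGen m (d ∷ δ) - (if (d ℕ.≡ᵇ 0) ∧ b then 1ℚ else 0ℚ)) δ-isOne ⟩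
    BGen m (d ∷ δ) - (if (d ℕ.≡ᵇ 0) ∧ false then 1ℚ else 0ℚ)
      ≡⟨ cong (λ b → BGen m (d ∷ δ) - (if b then 1ℚ else 0ℚ)) (Bool.∧-zeroʳ (d ℕ.≡ᵇ 0)) ⟩
    BGen m (d ∷ δ) - 0ℚ
      ≡⟨ +-identityʳ (BGen m (d ∷ δ)) ⟩
    BGen m (d ∷ δ)
      ≡⟨ by-degree (d ℕₚ.≟ deg δ) ⟩
    (if does (d ℕₚ.≟ deg δ) then ρ m δ else 0ℚ) ∎
    where
    by-degree : (d≟deg-δ : Dec (d ≡ deg δ)) → BGen m (d ∷ δ) ≡ (if does d≟deg-δ then ρ m δ else 0ℚ)
    by-degree (yes refl)    = sym (ρ≡BGen m δ)
    by-degree (no d≢deg-δ) = BGen-homogeneous m d δ d≢deg-δ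

isNonzero : Mono → Bool
isNonzero α = if isOne α then false else true

supportCands-δ : ∀ lam (g : Mono → ℚ) d {δ} → δ ≤ᴹ lam →
  ∑[ α ∈ supportCands lam ] (if does (d ∷ δ ≟ᴹ tx^ α) then g α else 0ℚ) ≡
  (if isOne δ then 0ℚ else (if does (d ℕₚ.≟ deg δ) then g δ else 0ℚ))
supportCands-δ lam g d {δ} δ≤lam = begin
  ∑ (supportCands lam) f                           ≡⟨ ∑-filterᵇ isNonzero (below lam) f ⟩
  ∑[ α ≤ᴹ lam ] (if isNonzero α then f α else 0ℚ)  ≡⟨ ∑≤-cong lam (λ α _ → term α (α ≟ᴹ δ)) ⟩
  ∑[ α ≤ᴹ lam ] (if does (α ≟ᴹ δ) then K else 0ℚ)  ≡⟨ ∑≤-δ lam δ (λ _ → K) ⟩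
  (if does (δ ≤ᴹ? lam) then K else 0ℚ)             ≡⟨ cong (if_then K else 0ℚ) (dec-true (δ ≤ᴹ? lam) δ≤lam) ⟩
  K                                                ∎
  where
  f : Mono → ℚ
  f α = if does (d ∷ δ ≟ᴹ tx^ α) then g α else 0ℚ
  K : ℚ
  K = if isOne δ then 0ℚ else (if does (d ℕₚ.≟ deg δ) then g δ else 0ℚ)
  term : ∀ α (α≟δ : Dec (α ≡ δ)) → (if isNonzero α then f α else 0ℚ) ≡ (if does α≟δ then K else 0ℚ)
  term α (yes refl)
    rewrite dec-true (α ≟ᴹ α) refl | Bool.∧-identityʳ (d ℕ.≡ᵇ deg α) with isOne α
  ... | true  = refl
  ... | false = refl
  term α (no α≢δ)
    rewrite dec-false (d ∷ δ ≟ᴹ tx^ α) (λ dδ≡tx^α → α≢δ (sym (List.∷-injectiveʳ dδ≡tx^α))) = Bool.if-eta (isNonzero α)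

BGen−oneS-on-supportCands : ∀ m lam d {δ} → δ ≤ᴹ lam →
  (BGen m −S oneS) (d ∷ δ) ≡ ∑[ α ∈ supportCands lam ] (if does (d ∷ δ ≟ᴹ tx^ α) then ρ m α else 0ℚ)
BGen−oneS-on-supportCands m lam d δ≤lam = trans (BGen−oneS-coefficient m d _) (sym (supportCands-δ lam (ρ m) d δ≤lam))

pS-BGen−oneS : ∀ m lam s N {β} → β ≤ᴹ N ∷ lam →
  pS s (BGen m −S oneS) β ≡ ∑[ α ∈ supportCands lam ] (if does (β ≟ᴹ scale (suc s) (tx^ α)) then ρ m α else 0ℚ)
pS-BGen−oneS m lam s N {β} β≤ with divisibleᴹ s β in β-divisible
... | false = sym (trans (∑-cong (supportCands lam) not-a-multiple) (∑-zero (supportCands lam)))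
  where
  not-a-multiple : ∀ α → (if does (β ≟ᴹ scale (suc s) (tx^ α)) then ρ m α else 0ℚ) ≡ 0ℚ
  not-a-multiple α = cong (if_then ρ m α else 0ℚ) (dec-false (β ≟ᴹ scale (suc s) (tx^ α)) λ β≡sα →
    true≢false (trans (sym (divisibleᴹ-scale s (tx^ α))) (trans (cong (divisibleᴹ s) (sym β≡sα)) β-divisible)))
    where
    true≢false : true ≢ false
    true≢false ()
pS-BGen−oneS m lam s N {b ∷ x} (_ ∷ x≤lam) | true = begin
  (BGen m −S oneS) (divideᴹ s (b ∷ x))
    ≡⟨ BGen−oneS-on-supportCands m lam (b ℕ./ suc s) (≤ᴹ-trans (divideᴹ-≤ᴹ s x) x≤lam) ⟩
  ∑[ α ∈ supportCands lam ] (if does (divideᴹ s (b ∷ x) ≟ᴹ tx^ α) then ρ m α else 0ℚ)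
    ≡⟨ ∑-cong (supportCands lam) (λ α → cong (if_then ρ m α else 0ℚ) (same-test α)) ⟩
  ∑[ α ∈ supportCands lam ] (if does (b ∷ x ≟ᴹ scale (suc s) (tx^ α)) then ρ m α else 0ℚ) ∎
  where
  exact : scale (suc s) (divideᴹ s (b ∷ x)) ≡ b ∷ x
  exact = scale-divideᴹ s (b ∷ x) β-divisible
  same-test : ∀ α → does (divideᴹ s (b ∷ x) ≟ᴹ tx^ α) ≡ does (b ∷ x ≟ᴹ scale (suc s) (tx^ α))
  same-test α = does-⇔ (mk⇔ (λ eq → trans (sym exact) (cong (scale (suc s)) eq))
                             (λ eq → scale-suc-injective s (trans exact eq)))
                       (divideᴹ s (b ∷ x) ≟ᴹ tx^ α) (b ∷ x ≟ᴹ scale (suc s) (tx^ α))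

psumS-BGen−oneS : ∀ m lam N {β} → β ≤ᴹ N ∷ lam →
  psumS (BGen m −S oneS) β ≡ ∑[ α ∈ supportCands lam ] negBinomialLog (ρ m α) (tx^ α) β
psumS-BGen−oneS m lam N {β} β≤ = begin
  ∑[ s < deg β ] (1/ℕ (suc s) * pS s (BGen m −S oneS) β)  ≡⟨ ∑<-cong (deg β) (λ s _ → term s) ⟩
  ∑[ s < deg β ] ∑[ α ∈ supportCands lam ] summand α s    ≡⟨ ∑-comm (supportCands lam) (upTo (deg β)) summand ⟨
  ∑[ α ∈ supportCands lam ] ∑[ s < deg β ] summand α s    ∎
  where
  summand : Mono → ℕ → ℚ
  summand α s = if does (β ≟ᴹ scale (suc s) (tx^ α)) then ρ m α * 1/ℕ (suc s) else 0ℚ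
  term : ∀ s → 1/ℕ (suc s) * pS s (BGen m −S oneS) β ≡ ∑[ α ∈ supportCands lam ] summand α s
  term s = begin
    1/ℕ (suc s) * pS s (BGen m −S oneS) β
      ≡⟨ cong (1/ℕ (suc s) *_) (pS-BGen−oneS m lam s N β≤) ⟩
    1/ℕ (suc s) * ∑[ α ∈ supportCands lam ] (if does (β ≟ᴹ scale (suc s) (tx^ α)) then ρ m α else 0ℚ)
      ≡⟨ *-distribˡ-∑ (1/ℕ (suc s)) (supportCands lam) _ ⟩
    ∑[ α ∈ supportCands lam ] (1/ℕ (suc s) * (if does (β ≟ᴹ scale (suc s) (tx^ α)) then ρ m α else 0ℚ))
      ≡⟨ ∑-cong (supportCands lam) (λ α →
            trans (if-*ˡ (does (β ≟ᴹ scale (suc s) (tx^ α))) (1/ℕ (suc s)) (ρ m α))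
                  (cong (λ x → if does (β ≟ᴹ scale (suc s) (tx^ α)) then x else 0ℚ) (*-comm (1/ℕ (suc s)) (ρ m α)))) ⟩
    ∑[ α ∈ supportCands lam ] summand α s ∎

-- The product of negative binomial series

negBinomialProduct : (Mono → ℚ) → List Mono → Series
negBinomialProduct c []       = oneS
negBinomialProduct c (α ∷ as) = mulS (negBinomial (c α) (tx^ α)) (negBinomialProduct c as)

negBinomialLogSum : (Mono → ℚ) → List Mono → Series
negBinomialLogSum c as β = ∑[ α ∈ as ] negBinomialLog (c α) (tx^ α) β

deg-tx^≢0 : ∀ α → deg α ≢ 0 → deg (tx^ α) ≢ 0
deg-tx^≢0 α deg-α≢0 eq = deg-α≢0 (ℕₚ.m+n≡0⇒m≡0 (deg α) eq)

negBinomialProduct-solvesExpODE : ∀ c {as} → All (λ α → deg α ≢ 0) as →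
  SolvesExpODE (negBinomialLogSum c as) (negBinomialProduct c as)
negBinomialProduct-solvesExpODE c []                 = oneS-solvesExpODE
negBinomialProduct-solvesExpODE c {α ∷ _} (α≢0 ∷ as≢0) =
  mulS-solvesExpODE (negBinomial-solvesExpODE (tx^ α) (deg-tx^≢0 α α≢0) (c α)) (negBinomialProduct-solvesExpODE c as≢0)

negBinomialProduct-deg≡0 : ∀ c {L as} → All (λ α → length α ≡ L) as →
  ∀ γ → length γ ≡ suc L → deg γ ≡ 0 → negBinomialProduct c as γ ≡ 1ℚ
negBinomialProduct-deg≡0 c []  γ _ deg-γ≡0 = cong (if_then 1ℚ else 0ℚ) (deg≡0⇒isOne γ deg-γ≡0)
negBinomialProduct-deg≡0 c {L} {α ∷ as} (length-α ∷ lengths) γ length-γ deg-γ≡0 = begin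
  ∑[ β ≤ᴹ γ ] (negBinomial (c α) (tx^ α) β * negBinomialProduct c as (γ ⊖ β))
    ≡⟨ ∑≤-deg≡0 γ _ deg-γ≡0 ⟩
  negBinomial (c α) (tx^ α) γ * negBinomialProduct c as (γ ⊖ γ)
    ≡⟨ cong₂ _*_ (negBinomial-deg≡0 (tx^ α) (c α) γ deg-γ≡0 (trans length-γ (cong suc (sym length-α))))
                 (negBinomialProduct-deg≡0 c lengths (γ ⊖ γ) (length-zipWith ℕ._∸_ γ γ length-γ length-γ) deg-γ⊖γ≡0) ⟩
  1ℚ * 1ℚ
    ≡⟨ *-identityˡ 1ℚ ⟩
  1ℚ ∎
  where
  deg-γ⊖γ≡0 : deg (γ ⊖ γ) ≡ 0
  deg-γ⊖γ≡0 = ℕₚ.n≤0⇒n≡0 (subst (deg (γ ⊖ γ) ≤_) deg-γ≡0 (≤ᴹ⇒deg≤ (⊖-≤ᴹ (≤ᴹ-refl {γ}))))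

multichooseProduct : (Mono → ℚ) → List ℕ → List Mono → ℚ
multichooseProduct c φ as = prodℚ (zipWith (λ φα α → multichoose (c α) φα) φ as)

-- The right-hand side of the theorem: the sum over φ : as → {0, …, B} with Σ_α φ(α) α = y
-- of Π_α binom(φ(α) + c(α) − 1, φ(α)).
solutionSum : (Mono → ℚ) → ℕ → List Mono → ℕ → Mono → ℚ
solutionSum c L as B y = ∑[ φ ∈ boxes (length as) B ] (if does (linComb L φ as ≟ᴹ y) then multichooseProduct c φ as else 0ℚ)

length-linComb : ∀ {L as} → All (λ α → length α ≡ L) as → ∀ φ → length (linComb L φ as) ≡ L
length-linComb {L} []                   []      = List.length-replicate L
length-linComb {L} []                   (_ ∷ _) = List.length-replicate L
length-linComb {L} (_ ∷ _)              []      = List.length-replicate L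
length-linComb {L} {α ∷ as} (length-α ∷ lengths) (J ∷ φ) =
  length-zipWith ℕ._+_ (map (J ℕ.*_) α) (linComb L φ as) (trans (List.length-map (J ℕ.*_) α) length-α) (length-linComb lengths φ)

∑-boxes-suc : ∀ N B (F : List ℕ → ℚ) → ∑ (boxes (suc N) B) F ≡ ∑[ J < suc B ] ∑[ φ ∈ boxes N B ] F (J ∷ φ)
∑-boxes-suc N B F = trans (∑-concatMap (λ J → map (J ∷_) (boxes N B)) (upTo (suc B)) F)
                          (∑<-cong (suc B) (λ J _ → ∑-map (J ∷_) (boxes N B) F))

isOne-tx^ : ∀ L x → length x ≡ L → isOne (tx^ x) ≡ does (replicate L 0 ≟ᴹ x)
isOne-tx^ L x length-x = by-cases (replicate L 0 ≟ᴹ x)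
  where
  deg-zeros : ∀ n → deg (replicate n 0) ≡ 0
  deg-zeros zero    = refl
  deg-zeros (suc n) = deg-zeros n
  by-cases : (zeros≟x : Dec (replicate L 0 ≡ x)) → isOne (tx^ x) ≡ does zeros≟x
  by-cases (yes refl) = deg≡0⇒isOne (tx^ x) (cong₂ ℕ._+_ (deg-zeros L) (deg-zeros L))
  by-cases (no zeros≢x) with isOne (tx^ x) in tx^x-isOne
  ... | false = refl
  ... | true  = contradiction (deg≡0-unique (replicate L 0) x (deg-zeros L)
                  (ℕₚ.m+n≡0⇒m≡0 (deg x) (isOne⇒deg≡0 (tx^ x) tx^x-isOne)) (trans (List.length-replicate L) (sym length-x))) zeros≢x

solutionSum-∷ : ∀ c {L} α as B x → length α ≡ L → All (λ α → length α ≡ L) as →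
  solutionSum c L (α ∷ as) B x ≡
  ∑[ J < suc B ] (if does (scale J α ≤ᴹ? x) then multichoose (c α) J * solutionSum c L as B (x ⊖ scale J α) else 0ℚ)
solutionSum-∷ c {L} α as B x length-α lengths = begin
  ∑ (boxes (suc N) B) F
    ≡⟨ ∑-boxes-suc N B F ⟩
  ∑[ J < suc B ] ∑[ φ ∈ boxes N B ] F (J ∷ φ)
    ≡⟨ ∑<-cong (suc B) (λ J _ → ∑-cong (boxes N B) (split J)) ⟩
  ∑[ J < suc B ] ∑[ φ ∈ boxes N B ] summand J (scale J α ≤ᴹ? x) φ
    ≡⟨ ∑<-cong (suc B) (λ J _ → row J (scale J α ≤ᴹ? x)) ⟩
  ∑[ J < suc B ] (if does (scale J α ≤ᴹ? x) then multichoose (c α) J * solutionSum c L as B (x ⊖ scale J α) else 0ℚ) ∎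
  where
  N : ℕ
  N = length as
  F : List ℕ → ℚ
  F φ = if does (linComb L φ (α ∷ as) ≟ᴹ x) then multichooseProduct c φ (α ∷ as) else 0ℚ
  summand : ∀ J → Dec (scale J α ≤ᴹ x) → List ℕ → ℚ
  summand J Jα≤?x φ = if does Jα≤?x ∧ does (linComb L φ as ≟ᴹ x ⊖ scale J α) then multichoose (c α) J * multichooseProduct c φ as else 0ℚ
  split : ∀ J φ → F (J ∷ φ) ≡ summand J (scale J α ≤ᴹ? x) φ
  split J φ = cong (if_then multichoose (c α) J * multichooseProduct c φ as else 0ℚ) (⊕-≟ᴹ-split (scale J α) (linComb L φ as) x
    (trans (List.length-map (J ℕ.*_) α) (trans length-α (sym (length-linComb lengths φ)))))
  row : ∀ J (Jα≤?x : Dec (scale J α ≤ᴹ x)) → ∑ (boxes N B) (summand J Jα≤?x) ≡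
    (if does Jα≤?x then multichoose (c α) J * solutionSum c L as B (x ⊖ scale J α) else 0ℚ)
  row J (no _)  = ∑-zero (boxes N B)
  row J (yes _) = sym (trans (*-distribˡ-∑ (multichoose (c α) J) (boxes N B) _) (∑-cong (boxes N B) (λ φ →
    if-*ˡ (does (linComb L φ as ≟ᴹ x ⊖ scale J α)) (multichoose (c α) J) (multichooseProduct c φ as))))

negBinomialProduct-coefficient : ∀ c {L as} → All (λ α → length α ≡ L) as → All (λ α → deg α ≢ 0) as →
  ∀ B x → length x ≡ L → deg x ≤ B → negBinomialProduct c as (tx^ x) ≡ solutionSum c L as B x
negBinomialProduct-coefficient c {L} {[]} [] [] B x length-x _ = begin
  oneS (tx^ x)                                         ≡⟨ cong (if_then 1ℚ else 0ℚ) (isOne-tx^ L x length-x) ⟩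
  (if does (replicate L 0 ≟ᴹ x) then 1ℚ else 0ℚ)       ≡⟨ +-identityʳ _ ⟨
  (if does (replicate L 0 ≟ᴹ x) then 1ℚ else 0ℚ) + 0ℚ  ∎
negBinomialProduct-coefficient c {L} {α ∷ as} (length-α ∷ lengths) (α≢0 ∷ as≢0) B x length-x deg-x≤B = begin
  mulS (negBinomial (c α) (tx^ α)) P (tx^ x)
    ≡⟨ mulS-negBinomial (tx^ α) (deg-tx^≢0 α α≢0) (c α) B P (tx^ x) too-large ⟩
  ∑[ J < suc B ] (if does (scale J (tx^ α) ≤ᴹ? tx^ x) then multichoose (c α) J * P (tx^ x ⊖ scale J (tx^ α)) else 0ℚ)
    ≡⟨ ∑<-cong (suc B) (λ J _ → column J) ⟩
  ∑[ J < suc B ] (if does (scale J α ≤ᴹ? x) then multichoose (c α) J * solutionSum c L as B (x ⊖ scale J α) else 0ℚ)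
    ≡⟨ solutionSum-∷ c α as B x length-α lengths ⟨
  solutionSum c L (α ∷ as) B x ∎
  where
  P : Series
  P = negBinomialProduct c as
  too-large : ∀ J → B < J → ¬ scale J (tx^ α) ≤ᴹ tx^ x
  too-large J B<J (_ ∷ Jα≤x) = ℕₚ.<⇒≱ B<J (ℕₚ.≤-trans (≤-deg-scale α α≢0 J) (ℕₚ.≤-trans (≤ᴹ⇒deg≤ Jα≤x) deg-x≤B))
  column : ∀ J → (if does (scale J (tx^ α) ≤ᴹ? tx^ x) then multichoose (c α) J * P (tx^ x ⊖ scale J (tx^ α)) else 0ℚ)
               ≡ (if does (scale J α ≤ᴹ? x) then multichoose (c α) J * solutionSum c L as B (x ⊖ scale J α) else 0ℚ)
  column J = begin
    (if does (scale J (tx^ α) ≤ᴹ? tx^ x) then multichoose (c α) J * P (tx^ x ⊖ scale J (tx^ α)) else 0ℚ)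
      ≡⟨ cong (λ w → if does (w ≤ᴹ? tx^ x) then multichoose (c α) J * P (tx^ x ⊖ w) else 0ℚ) (scale-tx^ J α) ⟩
    (if does (tx^ (scale J α) ≤ᴹ? tx^ x) then multichoose (c α) J * P (tx^ x ⊖ tx^ (scale J α)) else 0ℚ)
      ≡⟨ cong (if_then multichoose (c α) J * P (tx^ x ⊖ tx^ (scale J α)) else 0ℚ) (tx^-≤ᴹ? (scale J α) x) ⟩
    (if does (scale J α ≤ᴹ? x) then multichoose (c α) J * P (tx^ x ⊖ tx^ (scale J α)) else 0ℚ)
      ≡⟨ by-cases (scale J α ≤ᴹ? x) ⟩
    (if does (scale J α ≤ᴹ? x) then multichoose (c α) J * solutionSum c L as B (x ⊖ scale J α) else 0ℚ) ∎
    where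
    by-cases : (Jα≤?x : Dec (scale J α ≤ᴹ x)) →
      (if does Jα≤?x then multichoose (c α) J * P (tx^ x ⊖ tx^ (scale J α)) else 0ℚ)
      ≡ (if does Jα≤?x then multichoose (c α) J * solutionSum c L as B (x ⊖ scale J α) else 0ℚ)
    by-cases (no _)     = refl
    by-cases (yes Jα≤x) = cong (multichoose (c α) J *_) (trans (cong P (tx^-⊖ Jα≤x))
      (negBinomialProduct-coefficient c lengths as≢0 B (x ⊖ scale J α)
        (length-zipWith ℕ._∸_ x (scale J α) length-x (trans (List.length-map (J ℕ.*_) α) length-α))
        (ℕₚ.≤-trans (≤ᴹ⇒deg≤ (⊖-≤ᴹ Jα≤x)) deg-x≤B)))

supportCands-lengths : ∀ lam → All (λ α → length α ≡ length lam) (supportCands lam)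
supportCands-lengths lam = filter⁺ (T? ∘ isNonzero) (All.map Pointwise-length (below-≤ᴹ lam))

supportCands-nonzero : ∀ lam → All (λ α → deg α ≢ 0) (supportCands lam)
supportCands-nonzero lam = All.map (λ {α} α-nonzero deg-α≡0 → subst (λ b → T (if b then false else true)) (deg≡0⇒isOne α deg-α≡0) α-nonzero)
                                   (all-filter (T? ∘ isNonzero) (below lam))

BGen-suc≡negBinomialProduct : ∀ m lam γ → γ ≤ᴹ tx^ lam → BGen (suc m) γ ≡ negBinomialProduct (ρ m) (supportCands lam) γ
BGen-suc≡negBinomialProduct m lam =
  solvesExpODE-unique (tx^ lam) (expS-solvesExpODE G-constant-free) (negBinomialProduct-solvesExpODE (ρ m) (supportCands-nonzero lam))
    (λ β β≤ → psumS-BGen−oneS m lam (deg lam) β≤) constant-terms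
  where
  G : Series
  G = psumS (BGen m −S oneS)
  G-constant-free : NoConstantTerm G
  G-constant-free β deg-β≡0 = cong (λ n → ∑[ s < n ] (1/ℕ (suc s) * pS s (BGen m −S oneS) β)) deg-β≡0
  constant-terms : ∀ γ → γ ≤ᴹ tx^ lam → deg γ ≡ 0 → expS G γ ≡ negBinomialProduct (ρ m) (supportCands lam) γ
  constant-terms γ γ≤ deg-γ≡0 = trans (expS-deg≡0 G γ deg-γ≡0)
    (sym (negBinomialProduct-deg≡0 (ρ m) (supportCands-lengths lam) γ (Pointwise-length γ≤) deg-γ≡0))

solutionSum≡rhsSum : ∀ m lam → solutionSum (ρ m) (length lam) (supportCands lam) (deg lam) lam ≡ rhsSum m lam
solutionSum≡rhsSum m lam = trans (∑-cong (boxes (length as) (deg lam)) (λ φ →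
    cong (if_then multichooseProduct (ρ m) φ as else 0ℚ) (sym (eqᵇ≡does-≟ᴹ (linComb (length lam) φ as) lam))))
  (sym (∑-filterᵇ (λ φ → eqᵇ (linComb (length lam) φ as) lam) (boxes (length as) (deg lam)) _))
  where
  as : List Mono
  as = supportCands lam

mainTheorem5 : (m : ℕ) (λ′ : List ℕ) → IsNonemptyPartition λ′ →
    ρ (suc m) λ′ ≡ rhsSum m λ′
mainTheorem5 m λ′ _ = begin
  ρ (suc m) λ′                                                 ≡⟨ ρ≡BGen (suc m) λ′ ⟩
  BGen (suc m) (tx^ λ′)                                        ≡⟨ BGen-suc≡negBinomialProduct m λ′ (tx^ λ′) ≤ᴹ-refl ⟩
  negBinomialProduct (ρ m) (supportCands λ′) (tx^ λ′)          ≡⟨ negBinomialProduct-coefficient (ρ m) (supportCands-lengths λ′)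
                                                                    (supportCands-nonzero λ′) (deg λ′) λ′ refl ℕₚ.≤-refl ⟩
  solutionSum (ρ m) (length λ′) (supportCands λ′) (deg λ′) λ′  ≡⟨ solutionSum≡rhsSum m λ′ ⟩
  rhsSum m λ′                                                  ∎
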